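{- For $n\geqslant1$, $$\sum_{\pi\in\mathcal{S}_n}x^{\mathrm{lpk}(\pi)}=\sum_{\pi\in\mathcal{C}_n}2^{n-\mathrm{fix}(\pi)-2\mathrm{exc}(\pi)}x^{\mathrm{exc}(\pi)},$$ where $\mathcal{C}_n$ is the set of permutations in $\mathcal{S}_n$ with no cycle double ascents.
   Context: For $\pi\in\mathcal{S}_n$ (in one-line notation), a left peak is an index $i\in[n-1]$ with $\pi(i-1)<\pi(i)>\pi(i+1)$, where $\pi(0)=0$; $\mathrm{lpk}(\pi)$ is their number. $\mathrm{exc}(\pi)=\#\{i:\pi(i)>i\}$, $\mathrm{fix}(\pi)=\#\{i:\pi(i)=i\}$. A cycle double ascent of $\pi$ is an $i$ with $\pi^{ -1}(i)<i<\pi(i)$. -}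

module Defs where

open import Data.Nat using (ℕ; zero; suc; _+_; _*_; _∸_; _^_; _<_; _<?_)
open import Data.Nat.Properties using (_≟_)
open import Data.Fin using (Fin; toℕ)
import Data.Fin.Properties as FinP
open import Data.Vec using (Vec; []; _∷_; lookup; toList)
open import Data.List using (List; []; _∷_; concatMap; map; filter; length; allFin)
open import Data.Nat.ListAction using (sum)
import Data.List.Relation.Unary.Unique.DecPropositional as UDP
open import Data.List.Relation.Unary.Any using (any?)
open import Data.Product using (Σ; _×_; _,_)
open import Relation.Nullary using (Dec; yes; no; ¬_; ¬?)
open import Relation.Nullary.Decidable using (_×-dec_)
open import Relation.Binary.PropositionalEquality using (_≡_)

-- A permutation of [n] in one-line notation: position i (0-based Fin n, i.e.
-- position toℕ i + 1) carries the value toℕ (lookup π i) + 1.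
-- All words of length m over the alphabet Fin n:
words : (n m : ℕ) → List (Vec (Fin n) m)
words n zero    = [] ∷ []
words n (suc m) = concatMap (λ a → map (a ∷_) (words n m)) (allFin n)

IsPerm : {n : ℕ} → Vec (Fin n) n → Set
IsPerm {n} π = UDP.Unique FinP._≟_ (toList π)

isPerm? : {n : ℕ} → (π : Vec (Fin n) n) → Dec (IsPerm π)
isPerm? π = UDP.unique? FinP._≟_ (toList π)

S : (n : ℕ) → List (Vec (Fin n) n)
S n = filter isPerm? (words n n)

values : {n : ℕ} → Vec (Fin n) n → List ℕ
values π = Data.List.map (λ a → suc (toℕ a)) (toList π)

isPeak : ℕ → ℕ → ℕ → ℕ
isPeak a b c with a <? b | c <? b
... | yes _ | yes _ = 1
... | _     | _     = 0

peaks : List ℕ → ℕ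
peaks (a ∷ b ∷ c ∷ rest) = isPeak a b c + peaks (b ∷ c ∷ rest)
peaks _ = 0

-- left peaks: i ∈ [n-1] with π(i-1) < π(i) > π(i+1), π(0) = 0
lpk : {n : ℕ} → Vec (Fin n) n → ℕ
lpk π = peaks (0 ∷ values π)

exc : {n : ℕ} → Vec (Fin n) n → ℕ
exc {n} π = length (filter (λ i → toℕ i <? toℕ (lookup π i)) (allFin n))

fix : {n : ℕ} → Vec (Fin n) n → ℕ
fix {n} π = length (filter (λ i → toℕ (lookup π i) ≟ toℕ i) (allFin n))

CDA : {n : ℕ} → Vec (Fin n) n → Fin n → Set
CDA {n} π i = Σ (Fin n) (λ j → (lookup π j ≡ i) × (toℕ j < toℕ i)) × (toℕ i < toℕ (lookup π i))

cda? : {n : ℕ} → (π : Vec (Fin n) n) → (i : Fin n) → Dec (CDA π i)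
cda? {n} π i = FinP.any? (λ j → (lookup π j FinP.≟ i) ×-dec (toℕ j <? toℕ i)) ×-dec (toℕ i <? toℕ (lookup π i))

NoCDA : {n : ℕ} → Vec (Fin n) n → Set
NoCDA {n} π = ¬ Σ (Fin n) (λ i → CDA π i)

noCDA? : {n : ℕ} → (π : Vec (Fin n) n) → Dec (NoCDA π)
noCDA? π = ¬? (FinP.any? (cda? π))

C : (n : ℕ) → List (Vec (Fin n) n)
C n = filter noCDA? (S n)

-- coefficient of x^k in Σ_{π ∈ S_n} x^{lpk π}
lpkCoeff : (n k : ℕ) → ℕ
lpkCoeff n k = length (filter (λ π → lpk π ≟ k) (S n))

-- coefficient of x^k in Σ_{π ∈ C_n} 2^{n - fix π - 2 exc π} x^{exc π}
excCoeff : (n k : ℕ) → ℕ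
excCoeff n k = sum (map (λ π → 2 ^ (n ∸ fix π ∸ 2 * exc π)) (filter (λ π → exc π ≟ k) (C n)))

-- Inserting n + 1 into the one-line notation of a permutation of [n] with k left peaks keeps k at 2k + 1
-- of the n + 1 positions (next to a peak, or at the end) and raises it to k + 1 at the others. Inserting n + 1 into the
-- cycles instead, as a fixed point or right after some a, changes (cycle valleys, double descents, double ascents) in
-- one of five ways, and summing over all insertions shows that cycle valleys obey the same recurrence as left peaks.
-- The same bookkeeping shows that the number of permutations with statistics (k, d, e) is binom(d + e, e) times the
-- number with (k, d + e, 0), so splitting m = d + e over all permutations with k cycle valleys gives 2^m times the
-- permutations with k valleys, m double descents and no double ascent. For the latter exc = cval and
-- n − fix − 2 exc = cdd, which is the right-hand side.

module Submission where

open import Defs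
open import Data.Nat using (ℕ; _≤_)
open import Relation.Binary.PropositionalEquality using (_≡_)

open import Data.Nat using (zero; suc; pred; _+_; _*_; _∸_; _^_; _<_; _<?_; _≤?_; z≤n; s≤s; s≤s⁻¹; z<s)
open import Data.Nat.Properties
import Data.Nat.ListAction as ListAction
import Data.Nat.ListAction.Properties as ListAction
open import Data.Fin as F using (Fin; toℕ; inject₁; fromℕ; punchIn; punchOut)
import Data.Fin.Properties as FinP
import Data.Fin.Permutation as Perm
open import Data.Vec as V using (Vec; []; _∷_; lookup; toList; _∷ʳ_; _[_]≔_; insertAt; removeAt; init; last; initLast)
import Data.Vec.Properties as VP
open import Data.List as L using (List; []; _∷_; filter; length; allFin; cartesianProductWith)
import Data.List.Properties as L
open import Data.List.Membership.Propositional using (_∈_)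
open import Data.List.Membership.Propositional.Properties
  using (∈-concat⁺′; ∈-map⁺; ∈-allFin; ∈-filter⁺; ∈-filter⁻; ∈-cartesianProductWith⁺; ∈-cartesianProductWith⁻)
open import Data.List.Membership.Propositional.Properties.WithK using (unique∧set⇒bag)
open import Data.List.Relation.Binary.BagAndSetEquality using (∼bag⇒↭)
import Data.List.Relation.Binary.Permutation.Propositional.Properties as ↭
open import Data.List.Relation.Unary.Any using (here; there)
open import Data.List.Relation.Unary.All using (All; []; _∷_)
open import Data.List.Relation.Unary.AllPairs using (AllPairs; []; _∷_)
import Data.List.Relation.Unary.Unique.Propositional as Unique
import Data.List.Relation.Unary.Unique.Propositional.Properties as Unique
open import Data.Product using (Σ; ∃; _×_; _,_; proj₁; proj₂)
open import Data.Sum using (_⊎_; inj₁; inj₂)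
open import Data.Empty using (⊥; ⊥-elim)
open import Function using (_∘_; mk⇔)
open import Relation.Nullary using (Dec; yes; no; ¬_; does)
open import Data.Bool using (if_then_else_)
open import Relation.Nullary.Decidable using (_×-dec_)
open import Relation.Binary using (tri<; tri≈; tri>)
open import Relation.Binary.PropositionalEquality using (refl; sym; trans; cong; cong₂; subst; subst₂; _≢_; module ≡-Reasoning)
open import Algebra.Properties.Semiring.Sum +-*-semiring
  using (sum; sum-syntax; sum-cong-≗; *-distribˡ-sum; *-distribʳ-sum; sum-init-last; sum-replicate-zero)
open import Algebra.Properties.CommutativeMonoid.Sum +-0-commutativeMonoid using (∑-distrib-+; sum-permute; sum-remove)
open import Algebra.Properties.CommutativeSemigroup +-commutativeSemigroup using (interchange)
open import Data.Vec.Functional using (updateAt)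
open import Data.Vec.Functional.Properties using (updateAt-updates; updateAt-minimal)
open import Data.Nat.Combinatorics renaming (_C_ to _choose_) using (nCk+nC[k+1]≡[n+1]C[k+1]; nC1≡n; nCn≡1; nCk≡nC[n∸k])
open import Data.Nat.Combinatorics.Specification using (k>n⇒nCk≡0)
import Algebra.Properties.CommutativeSemiring.Binomial +-*-commutativeSemiring as Binomial
open import Algebra.Bundles using (CommutativeSemiring)
open import Data.Nat.Solver using (module +-*-Solver)
open +-*-Solver using (solve; _:+_; _:*_; _:=_; con)

-- Defined through does, so that 𝟙 (suc a ≟ suc b) reduces to 𝟙 (a ≟ b).
𝟙 : ∀ {p} {P : Set p} → Dec P → ℕ
𝟙 d = if does d then 1 else 0

𝟙-yes : ∀ {p} {P : Set p} (d : Dec P) → P → 𝟙 d ≡ 1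
𝟙-yes (yes _) _  = refl
𝟙-yes (no ¬p) p = ⊥-elim (¬p p)

𝟙-no : ∀ {p} {P : Set p} (d : Dec P) → ¬ P → 𝟙 d ≡ 0
𝟙-no (yes p) ¬p = ⊥-elim (¬p p)
𝟙-no (no _)  _  = refl

𝟙-⇔ : ∀ {p q} {P : Set p} {Q : Set q} (d : Dec P) (e : Dec Q) → (P → Q) → (Q → P) → 𝟙 d ≡ 𝟙 e
𝟙-⇔ (yes p) (yes q) _ _ = refl
𝟙-⇔ (yes p) (no ¬q) f _ = ⊥-elim (¬q (f p))
𝟙-⇔ (no ¬p) (yes q) _ g = ⊥-elim (¬p (g q))
𝟙-⇔ (no _)  (no _)  _ _ = refl

𝟙-× : ∀ {p q} {P : Set p} {Q : Set q} (d : Dec P) (e : Dec Q) → 𝟙 (d ×-dec e) ≡ 𝟙 d * 𝟙 e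
𝟙-× (yes _) (yes _) = refl
𝟙-× (yes _) (no _)  = refl
𝟙-× (no _)  _       = refl

𝟙≡1⇒ : ∀ {p} {P : Set p} (d : Dec P) → 𝟙 d ≡ 1 → P
𝟙≡1⇒ (yes p) _ = p

𝟙≟-* : ∀ x k (c : ℕ → ℕ) → 𝟙 (x ≟ k) * c x ≡ 𝟙 (x ≟ k) * c k
𝟙≟-* x k c = pin (x ≟ k)
  where
  pin : (d : Dec (x ≡ k)) → 𝟙 d * c x ≡ 𝟙 d * c k
  pin (yes refl) = refl
  pin (no _)     = refl

∑∈ : ∀ {a} {A : Set a} → List A → (A → ℕ) → ℕ
∑∈ xs f = ListAction.sum (L.map f xs)

infixl 10 ∑∈
syntax ∑∈ xs (λ x → e) = ∑[ x ∈ xs ] e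

module _ {a} {A : Set a} where

  ∑∈-cong : ∀ (xs : List A) {f g : A → ℕ} → (∀ x → x ∈ xs → f x ≡ g x) → ∑∈ xs f ≡ ∑∈ xs g
  ∑∈-cong []       _ = refl
  ∑∈-cong (x ∷ xs) h = cong₂ _+_ (h x (here refl)) (∑∈-cong xs (λ y y∈xs → h y (there y∈xs)))

  ∑∈-zero : ∀ (xs : List A) → ∑∈ xs (λ _ → 0) ≡ 0
  ∑∈-zero []       = refl
  ∑∈-zero (_ ∷ xs) = ∑∈-zero xs

  ∑∈-distrib-+ : ∀ (xs : List A) (f g : A → ℕ) → ∑∈ xs (λ x → f x + g x) ≡ ∑∈ xs f + ∑∈ xs g
  ∑∈-distrib-+ []       f g = refl
  ∑∈-distrib-+ (x ∷ xs) f g = begin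
    f x + g x + ∑∈ xs (λ y → f y + g y)  ≡⟨ cong (f x + g x +_) (∑∈-distrib-+ xs f g) ⟩
    f x + g x + (∑∈ xs f + ∑∈ xs g)      ≡⟨ interchange (f x) (g x) _ _ ⟩
    f x + ∑∈ xs f + (g x + ∑∈ xs g)      ∎
    where open ≡-Reasoning

  *-distribˡ-∑∈ : ∀ (xs : List A) c (f : A → ℕ) → ∑∈ xs (λ x → c * f x) ≡ c * ∑∈ xs f
  *-distribˡ-∑∈ []       c f = sym (*-zeroʳ c)
  *-distribˡ-∑∈ (x ∷ xs) c f =
    trans (cong (c * f x +_) (*-distribˡ-∑∈ xs c f)) (sym (*-distribˡ-+ c (f x) _))

  ∑∈-filter : ∀ {p} {P : A → Set p} (P? : ∀ x → Dec (P x)) (xs : List A) (h : A → ℕ) →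
              ∑∈ (filter P? xs) h ≡ ∑∈ xs (λ x → 𝟙 (P? x) * h x)
  ∑∈-filter P? []       h = refl
  ∑∈-filter P? (x ∷ xs) h with P? x
  ... | yes _ = cong₂ _+_ (sym (+-identityʳ (h x))) (∑∈-filter P? xs h)
  ... | no _  = ∑∈-filter P? xs h

  length-filter : ∀ {p} {P : A → Set p} (P? : ∀ x → Dec (P x)) (xs : List A) →
                  length (filter P? xs) ≡ ∑∈ xs (λ x → 𝟙 (P? x))
  length-filter P? []       = refl
  length-filter P? (x ∷ xs) with P? x
  ... | yes _ = cong suc (length-filter P? xs)
  ... | no _  = length-filter P? xs

  ∑∈-∑-comm : ∀ (xs : List A) m (f : A → Fin m → ℕ) →
              ∑[ x ∈ xs ] (∑[ i < m ] f x i) ≡ ∑[ i < m ] (∑[ x ∈ xs ] f x i)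
  ∑∈-∑-comm []       m f = sym (sum-replicate-zero m)
  ∑∈-∑-comm (x ∷ xs) m f =
    trans (cong (sum (f x) +_) (∑∈-∑-comm xs m f)) (sym (∑-distrib-+ (f x) (λ i → ∑∈ xs (λ y → f y i))))

∑∈-tabulate : ∀ {a} {A : Set a} {n} (g : Fin n → A) (f : A → ℕ) → ∑∈ (L.tabulate g) f ≡ ∑[ i < n ] f (g i)
∑∈-tabulate {n = zero}  g f = refl
∑∈-tabulate {n = suc n} g f = cong (f (g F.zero) +_) (∑∈-tabulate (g ∘ F.suc) f)

Distinct : ∀ {n m} → Vec (Fin n) m → Set
Distinct π = ∀ i j → lookup π i ≡ lookup π j → i ≡ j

module _ {n : ℕ} where

  private
    DistinctList : ∀ {m} → Vec (Fin n) m → Set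
    DistinctList π = AllPairs _≢_ (toList π)

    all⇒lookup : ∀ {m} {P : Fin n → Set} (xs : Vec (Fin n) m) → All P (toList xs) → ∀ j → P (lookup xs j)
    all⇒lookup (x ∷ xs) (px ∷ _)  F.zero    = px
    all⇒lookup (x ∷ xs) (_ ∷ pxs) (F.suc j) = all⇒lookup xs pxs j

    lookup⇒all : ∀ {m} {P : Fin n → Set} (xs : Vec (Fin n) m) → (∀ j → P (lookup xs j)) → All P (toList xs)
    lookup⇒all []       _ = []
    lookup⇒all (x ∷ xs) h = h F.zero ∷ lookup⇒all xs (h ∘ F.suc)

    distinctList⇒distinct : ∀ {m} (π : Vec (Fin n) m) → DistinctList π → Distinct π
    distinctList⇒distinct (x ∷ xs) (x∉ ∷ _) F.zero    F.zero    _ = refl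
    distinctList⇒distinct (x ∷ xs) (x∉ ∷ _) F.zero    (F.suc j) e = ⊥-elim (all⇒lookup xs x∉ j e)
    distinctList⇒distinct (x ∷ xs) (x∉ ∷ _) (F.suc i) F.zero    e = ⊥-elim (all⇒lookup xs x∉ i (sym e))
    distinctList⇒distinct (x ∷ xs) (_ ∷ d)  (F.suc i) (F.suc j) e = cong F.suc (distinctList⇒distinct xs d i j e)

    distinct⇒distinctList : ∀ {m} (π : Vec (Fin n) m) → Distinct π → DistinctList π
    distinct⇒distinctList []       _ = []
    distinct⇒distinctList (x ∷ xs) d =
      lookup⇒all xs (λ j e → 0≢suc (d F.zero (F.suc j) e))
      ∷ distinct⇒distinctList xs (λ i j e → FinP.suc-injective (d (F.suc i) (F.suc j) e))
      where
      0≢suc : ∀ {k} {j : Fin k} → F.zero ≢ F.suc j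
      0≢suc ()

  isPerm⇒distinct : (π : Vec (Fin n) n) → IsPerm π → Distinct π
  isPerm⇒distinct = distinctList⇒distinct

  distinct⇒isPerm : (π : Vec (Fin n) n) → Distinct π → IsPerm π
  distinct⇒isPerm = distinct⇒distinctList

-- A pigeonhole argument: a missed value would give an injection Fin (suc m) → Fin m.
injective⇒surjective : ∀ {n} (f : Fin n → Fin n) → (∀ i j → f i ≡ f j → i ≡ j) → ∀ v → ∃ λ i → f i ≡ v
injective⇒surjective {n} f inj v with FinP.any? (λ i → f i FinP.≟ v)
... | yes hit = hit
... | no miss = ⊥-elim (pigeonhole n f inj v miss)
  where
  pigeonhole : ∀ n (f : Fin n → Fin n) → (∀ i j → f i ≡ f j → i ≡ j) → (v : Fin n) → ¬ (∃ λ i → f i ≡ v) → ⊥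
  pigeonhole (suc m) f inj v miss = <-irrefl refl (FinP.injective⇒≤ {f = g} g-injective)
    where
    g : Fin (suc m) → Fin m
    g i = punchOut {i = v} {j = f i} (λ e → miss (i , sym e))
    g-injective : ∀ {i j} → g i ≡ g j → i ≡ j
    g-injective {i} {j} e = inj i j (FinP.punchOut-injective (λ e → miss (i , sym e)) (λ e → miss (j , sym e)) e)

module _ {n : ℕ} (π : Vec (Fin n) n) (π-distinct : Distinct π) where

  preimage : ∀ v → ∃ λ i → lookup π i ≡ v
  preimage = injective⇒surjective (lookup π) π-distinct

  ∑-reindex : (f : Fin n → ℕ) → ∑[ i < n ] f (lookup π i) ≡ ∑[ i < n ] f i
  ∑-reindex f = sym (sum-permute f ρ)
    where
    ρ : Perm.Permutation n n
    ρ = Perm.permutation (lookup π) (proj₁ ∘ preimage) (proj₂ ∘ preimage)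
          (λ i → π-distinct _ _ (proj₂ (preimage (lookup π i))))

words-complete : ∀ n m (v : Vec (Fin n) m) → v ∈ words n m
words-complete n zero    []      = here refl
words-complete n (suc m) (a ∷ w) =
  ∈-concat⁺′ (∈-map⁺ (a ∷_) (words-complete n m w)) (∈-map⁺ (λ a → L.map (a ∷_) (words n m)) (∈-allFin a))

words-unique : ∀ n m → Unique.Unique (words n m)
words-unique n zero    = [] ∷ []
words-unique n (suc m) = subst Unique.Unique (sym (concatMap≡cartesianProduct (allFin n) (words n m)))
  (Unique.cartesianProductWith⁺ _∷_ VP.∷-injective (Unique.allFin⁺ n) (words-unique n m))
  where
  concatMap≡cartesianProduct : ∀ {n m} (xs : List (Fin n)) (ys : List (Vec (Fin n) m)) →
    L.concatMap (λ a → L.map (a ∷_) ys) xs ≡ cartesianProductWith _∷_ xs ys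
  concatMap≡cartesianProduct []       ys = refl
  concatMap≡cartesianProduct (x ∷ xs) ys = cong (L.map (x ∷_) ys L.++_) (concatMap≡cartesianProduct xs ys)

S-unique : ∀ n → Unique.Unique (S n)
S-unique n = Unique.filter⁺ isPerm? (words-unique n n)

∈-S : ∀ {n} (σ : Vec (Fin n) n) → Distinct σ → σ ∈ S n
∈-S {n} σ d = ∈-filter⁺ isPerm? (words-complete n n σ) (distinct⇒isPerm σ d)

∈-S⇒distinct : ∀ {n} {σ : Vec (Fin n) n} → σ ∈ S n → Distinct σ
∈-S⇒distinct {n} {σ} σ∈S = isPerm⇒distinct σ (proj₂ (∈-filter⁻ isPerm? {xs = words n n} σ∈S))

∑∈-cartesianProductWith : ∀ {A B C : Set} (f : A → B → C) (xs : List A) (ys : List B) (h : C → ℕ) →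
  ∑∈ (cartesianProductWith f xs ys) h ≡ ∑[ x ∈ xs ] (∑[ y ∈ ys ] h (f x y))
∑∈-cartesianProductWith f []       ys h = refl
∑∈-cartesianProductWith f (x ∷ xs) ys h = begin
  ListAction.sum (L.map h (L.map (f x) ys L.++ cartesianProductWith f xs ys))
    ≡⟨ cong ListAction.sum (L.map-++ h (L.map (f x) ys) _) ⟩
  ListAction.sum (L.map h (L.map (f x) ys) L.++ L.map h (cartesianProductWith f xs ys))
    ≡⟨ ListAction.sum-++ (L.map h (L.map (f x) ys)) _ ⟩
  ∑∈ (L.map (f x) ys) h + ∑∈ (cartesianProductWith f xs ys) h
    ≡⟨ cong₂ _+_ (cong ListAction.sum (sym (L.map-∘ ys))) (∑∈-cartesianProductWith f xs ys h) ⟩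
  ∑[ y ∈ ys ] h (f x y) + ∑[ x′ ∈ xs ] (∑[ y ∈ ys ] h (f x′ y)) ∎
  where open ≡-Reasoning

∑∈-bag : ∀ {A : Set} {xs ys : List A} → Unique.Unique xs → Unique.Unique ys →
         (∀ {z} → z ∈ xs → z ∈ ys) → (∀ {z} → z ∈ ys → z ∈ xs) → (h : A → ℕ) → ∑∈ xs h ≡ ∑∈ ys h
∑∈-bag xs-unique ys-unique to from h =
  ListAction.sum-↭ (↭.map⁺ h (∼bag⇒↭ (unique∧set⇒bag xs-unique ys-unique (mk⇔ to from))))

module Enumeration {n : ℕ}
  (ins : Vec (Fin n) n → Fin (suc n) → Vec (Fin (suc n)) (suc n))
  (del : Vec (Fin (suc n)) (suc n) → Vec (Fin n) n × Fin (suc n))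
  (del∘ins : ∀ π j → del (ins π j) ≡ (π , j))
  (ins-distinct : ∀ π j → Distinct π → Distinct (ins π j))
  (del-distinct : ∀ σ → Distinct σ → Distinct (proj₁ (del σ)))
  (ins∘del : ∀ σ → Distinct σ → ins (proj₁ (del σ)) (proj₂ (del σ)) ≡ σ) where

  ∑-S-suc : (h : Vec (Fin (suc n)) (suc n) → ℕ) →
            ∑[ σ ∈ S (suc n) ] h σ ≡ ∑[ π ∈ S n ] (∑[ j < suc n ] h (ins π j))
  ∑-S-suc h = begin
    ∑[ σ ∈ S (suc n) ] h σ                                ≡⟨ ∑∈-bag (S-unique (suc n)) images-unique to from h ⟩
    ∑∈ images h                                           ≡⟨ ∑∈-cartesianProductWith ins (S n) (allFin (suc n)) h ⟩
    ∑[ π ∈ S n ] (∑[ j ∈ allFin (suc n) ] h (ins π j))   ≡⟨ ∑∈-cong (S n) (λ π _ → ∑∈-tabulate (λ j → j) (h ∘ ins π)) ⟩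
    ∑[ π ∈ S n ] (∑[ j < suc n ] h (ins π j))            ∎
    where
    open ≡-Reasoning
    images = cartesianProductWith ins (S n) (allFin (suc n))

    ins-injective : ∀ {π π′ j j′} → ins π j ≡ ins π′ j′ → π ≡ π′ × j ≡ j′
    ins-injective {π} {π′} {j} {j′} e with trans (sym (del∘ins π j)) (trans (cong del e) (del∘ins π′ j′))
    ... | refl = refl , refl

    images-unique : Unique.Unique images
    images-unique = Unique.cartesianProductWith⁺ ins ins-injective (S-unique n) (Unique.allFin⁺ (suc n))

    to : ∀ {σ} → σ ∈ S (suc n) → σ ∈ images
    to {σ} σ∈S = subst (_∈ images) (ins∘del σ (∈-S⇒distinct σ∈S))
      (∈-cartesianProductWith⁺ ins (∈-S _ (del-distinct σ (∈-S⇒distinct σ∈S))) (∈-allFin (proj₂ (del σ))))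

    from : ∀ {σ} → σ ∈ images → σ ∈ S (suc n)
    from σ∈images with ∈-cartesianProductWith⁻ ins (S n) (allFin (suc n)) σ∈images
    ... | π , j , π∈S , _ , refl = ∈-S _ (ins-distinct π j (∈-S⇒distinct π∈S))

-- A left inverse of inject₁; the top value goes to a junk value.
clamp : ∀ {n} → Fin (suc (suc n)) → Fin (suc n)
clamp F.zero = F.zero
clamp {zero} (F.suc _) = F.zero
clamp {suc n} (F.suc x) = F.suc (clamp x)

clamp-inject₁ : ∀ {n} (x : Fin (suc n)) → clamp (inject₁ x) ≡ x
clamp-inject₁ F.zero = refl
clamp-inject₁ {suc n} (F.suc x) = cong F.suc (clamp-inject₁ x)

inject₁-clamp : ∀ {n} (x : Fin (suc (suc n))) → ¬ x ≡ fromℕ (suc n) → inject₁ (clamp x) ≡ x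
inject₁-clamp F.zero ne = refl
inject₁-clamp {zero} (F.suc F.zero) ne = ⊥-elim (ne refl)
inject₁-clamp {suc n} (F.suc x) ne = cong F.suc (inject₁-clamp x (λ e → ne (cong F.suc e)))

lowerAll : ∀ {n} → Vec (Fin (suc n)) n → Vec (Fin n) n
lowerAll {zero} [] = []
lowerAll {suc n} v = V.map clamp v

map-id-on : ∀ {A : Set} {m} (f : A → A) (v : Vec A m) → (∀ i → f (lookup v i) ≡ lookup v i) → V.map f v ≡ v
map-id-on f [] h = refl
map-id-on f (x ∷ v) h = cong₂ _∷_ (h F.zero) (map-id-on f v (λ i → h (F.suc i)))

lowerAll-map-inject₁ : ∀ {n} (π : Vec (Fin n) n) → lowerAll (V.map inject₁ π) ≡ π
lowerAll-map-inject₁ {zero} [] = refl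
lowerAll-map-inject₁ {suc n} π = trans (sym (VP.map-∘ clamp inject₁ π)) (map-id-on _ π (λ i → clamp-inject₁ _))

map-inject₁-lowerAll : ∀ {n} (v : Vec (Fin (suc n)) n) → (∀ i → ¬ lookup v i ≡ fromℕ n) → V.map inject₁ (lowerAll v) ≡ v
map-inject₁-lowerAll {zero} [] h = refl
map-inject₁-lowerAll {suc n} v h = trans (sym (VP.map-∘ inject₁ clamp v)) (map-id-on _ v (λ i → inject₁-clamp _ (h i)))

inject₁-lookup-lowerAll : ∀ {n} (v : Vec (Fin (suc n)) n) → (∀ i → lookup v i ≢ fromℕ n) →
                          ∀ i → inject₁ (lookup (lowerAll v) i) ≡ lookup v i
inject₁-lookup-lowerAll v h i =
  trans (sym (VP.lookup-map i inject₁ (lowerAll v))) (cong (λ w → lookup w i) (map-inject₁-lowerAll v h))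

lowerAll-distinct : ∀ {n} (v : Vec (Fin (suc n)) n) → (∀ i → ¬ lookup v i ≡ fromℕ n) → Distinct v → Distinct (lowerAll v)
lowerAll-distinct v h v-distinct i j e =
  v-distinct i j (trans (sym (inject₁-lookup-lowerAll v h i)) (trans (cong inject₁ e) (inject₁-lookup-lowerAll v h j)))

punchIn-view : ∀ {n} (j i : Fin (suc n)) → i ≡ j ⊎ ∃ λ k → i ≡ punchIn j k
punchIn-view j i with j FinP.≟ i
... | yes e = inj₁ (sym e)
... | no ne = inj₂ (punchOut ne , sym (FinP.punchIn-punchOut ne))

inject₁-view : ∀ {n} (i : Fin (suc n)) → i ≡ fromℕ n ⊎ ∃ λ k → i ≡ inject₁ k
inject₁-view {zero} F.zero = inj₁ refl
inject₁-view {suc n} F.zero = inj₂ (F.zero , refl)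
inject₁-view {suc n} (F.suc i) with inject₁-view i
... | inj₁ e = inj₁ (cong F.suc e)
... | inj₂ (k , e) = inj₂ (F.suc k , cong F.suc e)

lookup-removeAt : ∀ {A : Set} {n} (xs : Vec A (suc n)) p (k : Fin n) → lookup (removeAt xs p) k ≡ lookup xs (punchIn p k)
lookup-removeAt xs p k =
  trans (cong (lookup (removeAt xs p)) (sym (FinP.punchOut-punchIn p))) (VP.removeAt-punchOut xs (FinP.punchInᵢ≢i p k ∘ sym))

lookup-∷ʳ-inj : ∀ {A : Set} {n} (xs : Vec A n) y (k : Fin n) → lookup (xs ∷ʳ y) (inject₁ k) ≡ lookup xs k
lookup-∷ʳ-inj (x ∷ xs) y F.zero = refl
lookup-∷ʳ-inj (x ∷ xs) y (F.suc k) = lookup-∷ʳ-inj xs y k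

lookup-∷ʳ-top : ∀ {A : Set} {n} (xs : Vec A n) y → lookup (xs ∷ʳ y) (fromℕ n) ≡ y
lookup-∷ʳ-top [] y = refl
lookup-∷ʳ-top (x ∷ xs) y = lookup-∷ʳ-top xs y

init∷ʳlast : ∀ {A : Set} {n} (σ : Vec A (suc n)) → σ ≡ init σ ∷ʳ last σ
init∷ʳlast σ = proj₂ (proj₂ (initLast σ))

lookup-init : ∀ {A : Set} {n} (σ : Vec A (suc n)) k → lookup (init σ) k ≡ lookup σ (inject₁ k)
lookup-init σ k = trans (sym (lookup-∷ʳ-inj (init σ) (last σ) k)) (cong (λ w → lookup w (inject₁ k)) (sym (init∷ʳlast σ)))

lookup-last : ∀ {A : Set} {n} (σ : Vec A (suc n)) → last σ ≡ lookup σ (fromℕ n)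
lookup-last {n = n} σ = trans (sym (lookup-∷ʳ-top (init σ) (last σ))) (cong (λ w → lookup w (fromℕ n)) (sym (init∷ʳlast σ)))

lineInsert : ∀ {n} → Vec (Fin n) n → Fin (suc n) → Vec (Fin (suc n)) (suc n)
lineInsert {n} π j = insertAt (V.map inject₁ π) j (fromℕ n)

maxPosition : ∀ {n} → Vec (Fin (suc n)) (suc n) → Fin (suc n)
maxPosition {n} σ with FinP.any? (λ i → lookup σ i FinP.≟ fromℕ n)
... | yes (i , _) = i
... | no _ = F.zero

lineRemove : ∀ {n} → Vec (Fin (suc n)) (suc n) → Vec (Fin n) n × Fin (suc n)
lineRemove σ = lowerAll (removeAt σ (maxPosition σ)) , maxPosition σ

lineInsert-punchIn : ∀ {n} (π : Vec (Fin n) n) j k → lookup (lineInsert π j) (punchIn j k) ≡ inject₁ (lookup π k)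
lineInsert-punchIn π j k = trans (VP.insertAt-punchIn _ j _ k) (VP.lookup-map k inject₁ π)

lineInsert-at : ∀ {n} (π : Vec (Fin n) n) j → lookup (lineInsert π j) j ≡ fromℕ n
lineInsert-at π j = VP.insertAt-lookup _ j _

maxPosition-unique : ∀ {n} (σ : Vec (Fin (suc n)) (suc n)) p → lookup σ p ≡ fromℕ n →
              (∀ q → lookup σ q ≡ fromℕ n → q ≡ p) → maxPosition σ ≡ p
maxPosition-unique {n} σ p e u with FinP.any? (λ i → lookup σ i FinP.≟ fromℕ n)
... | yes (i , ei) = u i ei
... | no ne = ⊥-elim (ne (p , e))

maxPosition-lineInsert : ∀ {n} (π : Vec (Fin n) n) j → maxPosition (lineInsert π j) ≡ j
maxPosition-lineInsert π j = maxPosition-unique (lineInsert π j) j (lineInsert-at π j) u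
  where
  u : ∀ q → lookup (lineInsert π j) q ≡ fromℕ _ → q ≡ j
  u q e with punchIn-view j q
  ... | inj₁ eq = eq
  ... | inj₂ (k , refl) = ⊥-elim (FinP.fromℕ≢inject₁ (trans (sym e) (lineInsert-punchIn π j k)))

lineRemove∘lineInsert : ∀ {n} (π : Vec (Fin n) n) j → lineRemove (lineInsert π j) ≡ (π , j)
lineRemove∘lineInsert π j rewrite maxPosition-lineInsert π j | VP.removeAt-insertAt (V.map inject₁ π) j (fromℕ _) =
  cong (_, j) (lowerAll-map-inject₁ π)

lineInsert-distinct : ∀ {n} (π : Vec (Fin n) n) j → Distinct π → Distinct (lineInsert π j)
lineInsert-distinct π j π-distinct a b e with punchIn-view j a | punchIn-view j b
... | inj₁ refl | inj₁ refl = refl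
... | inj₁ refl | inj₂ (k , refl) =
  ⊥-elim (FinP.fromℕ≢inject₁ (trans (sym (lineInsert-at π j)) (trans e (lineInsert-punchIn π j k))))
... | inj₂ (k , refl) | inj₁ refl =
  ⊥-elim (FinP.fromℕ≢inject₁ (trans (sym (lineInsert-at π j)) (trans (sym e) (lineInsert-punchIn π j k))))
... | inj₂ (k , refl) | inj₂ (l , refl) =
  cong (punchIn j) (π-distinct k l (FinP.inject₁-injective
    (trans (sym (lineInsert-punchIn π j k)) (trans e (lineInsert-punchIn π j l)))))

module _ {n} (σ : Vec (Fin (suc n)) (suc n)) (σ-distinct : Distinct σ) where

  private
    p = maxPosition σ
    rest = removeAt σ p

    σp≡max : lookup σ p ≡ fromℕ n
    σp≡max with preimage σ σ-distinct (fromℕ n)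
    ... | q , σq≡max = subst (λ r → lookup σ r ≡ fromℕ n) (sym (maxPosition-unique σ q σq≡max unique)) σq≡max
      where
      unique : ∀ r → lookup σ r ≡ fromℕ n → r ≡ q
      unique r σr≡max = σ-distinct r q (trans σr≡max (sym σq≡max))

    rest-below-max : ∀ k → lookup rest k ≢ fromℕ n
    rest-below-max k e = FinP.punchInᵢ≢i p k (σ-distinct _ _ (trans (sym (lookup-removeAt σ p k)) (trans e (sym σp≡max))))

    rest-distinct : Distinct rest
    rest-distinct a b e =
      FinP.punchIn-injective p a b (σ-distinct _ _ (trans (sym (lookup-removeAt σ p a)) (trans e (lookup-removeAt σ p b))))

  lineRemove-distinct : Distinct (proj₁ (lineRemove σ))
  lineRemove-distinct = lowerAll-distinct rest rest-below-max rest-distinct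

  lineInsert∘lineRemove : lineInsert (proj₁ (lineRemove σ)) (proj₂ (lineRemove σ)) ≡ σ
  lineInsert∘lineRemove = begin
    insertAt (V.map inject₁ (lowerAll rest)) p (fromℕ n)
      ≡⟨ cong (λ w → insertAt w p (fromℕ n)) (map-inject₁-lowerAll rest rest-below-max) ⟩
    insertAt rest p (fromℕ n)                           ≡⟨ cong (insertAt rest p) (sym σp≡max) ⟩
    insertAt rest p (lookup σ p)                        ≡⟨ VP.insertAt-removeAt σ p ⟩
    σ                                                   ∎
    where open ≡-Reasoning

-- j = 0 adds n as a fixed point; j = a + 1 inserts n after a in its cycle: a ↦ n ↦ π a.
cycleInsert : ∀ {n} → Vec (Fin n) n → Fin (suc n) → Vec (Fin (suc n)) (suc n)
cycleInsert {n} π F.zero = V.map inject₁ π ∷ʳ fromℕ n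
cycleInsert {n} π (F.suc a) = (V.map inject₁ π [ a ]≔ fromℕ n) ∷ʳ inject₁ (lookup π a)

cycleRemove : ∀ {n} → Vec (Fin (suc n)) (suc n) → Vec (Fin n) n × Fin (suc n)
cycleRemove {n} σ with last σ FinP.≟ fromℕ n
... | yes _ = lowerAll (init σ) , F.zero
... | no _ with FinP.any? (λ a → lookup (init σ) a FinP.≟ fromℕ n)
...   | yes (a , _) = lowerAll (init σ [ a ]≔ last σ) , F.suc a
...   | no _ = lowerAll (init σ) , F.zero

cycleRemove-max-fixed : ∀ {n} (σ : Vec (Fin (suc n)) (suc n)) → last σ ≡ fromℕ n → cycleRemove σ ≡ (lowerAll (init σ) , F.zero)
cycleRemove-max-fixed {n} σ e with last σ FinP.≟ fromℕ n
... | yes _ = refl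
... | no ne = ⊥-elim (ne e)

cycleRemove-max-after : ∀ {n} (σ : Vec (Fin (suc n)) (suc n)) a → ¬ last σ ≡ fromℕ n → lookup (init σ) a ≡ fromℕ n →
       (∀ b → lookup (init σ) b ≡ fromℕ n → b ≡ a) → cycleRemove σ ≡ (lowerAll (init σ [ a ]≔ last σ) , F.suc a)
cycleRemove-max-after {n} σ a ne e u with last σ FinP.≟ fromℕ n
... | yes y = ⊥-elim (ne y)
... | no _ with FinP.any? (λ a → lookup (init σ) a FinP.≟ fromℕ n)
...   | yes (b , eb) rewrite u b eb = refl
...   | no nb = ⊥-elim (nb (a , e))

cycleInsert₀-inject₁ : ∀ {n} (π : Vec (Fin n) n) k → lookup (cycleInsert π F.zero) (inject₁ k) ≡ inject₁ (lookup π k)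
cycleInsert₀-inject₁ {n} π k = trans (lookup-∷ʳ-inj (V.map inject₁ π) (fromℕ n) k) (VP.lookup-map k inject₁ π)

cycleInsert₀-max : ∀ {n} (π : Vec (Fin n) n) → lookup (cycleInsert π F.zero) (fromℕ n) ≡ fromℕ n
cycleInsert₀-max {n} π = lookup-∷ʳ-top (V.map inject₁ π) (fromℕ n)

cycleInsert-at : ∀ {n} (π : Vec (Fin n) n) a → lookup (cycleInsert π (F.suc a)) (inject₁ a) ≡ fromℕ n
cycleInsert-at {n} π a =
  trans (lookup-∷ʳ-inj (V.map inject₁ π [ a ]≔ fromℕ n) _ a) (VP.lookup∘update a (V.map inject₁ π) (fromℕ n))

cycleInsert-other : ∀ {n} (π : Vec (Fin n) n) a k → ¬ a ≡ k → lookup (cycleInsert π (F.suc a)) (inject₁ k) ≡ inject₁ (lookup π k)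
cycleInsert-other {n} π a k a≢k = trans (lookup-∷ʳ-inj (V.map inject₁ π [ a ]≔ fromℕ n) _ k)
  (trans (VP.lookup∘update′ (a≢k ∘ sym) (V.map inject₁ π) (fromℕ n)) (VP.lookup-map k inject₁ π))

cycleInsert-max : ∀ {n} (π : Vec (Fin n) n) a → lookup (cycleInsert π (F.suc a)) (fromℕ n) ≡ inject₁ (lookup π a)
cycleInsert-max {n} π a = lookup-∷ʳ-top (V.map inject₁ π [ a ]≔ fromℕ n) _

cycleRemove∘cycleInsert : ∀ {n} (π : Vec (Fin n) n) j → cycleRemove (cycleInsert π j) ≡ (π , j)
cycleRemove∘cycleInsert {n} π F.zero = begin
  cycleRemove (V.map inject₁ π ∷ʳ fromℕ n)
    ≡⟨ cycleRemove-max-fixed (cycleInsert π F.zero) (VP.last-∷ʳ (fromℕ n) (V.map inject₁ π)) ⟩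
  lowerAll (init (V.map inject₁ π ∷ʳ fromℕ n)) , F.zero
    ≡⟨ cong (λ w → lowerAll w , F.zero) (VP.init-∷ʳ (fromℕ n) (V.map inject₁ π)) ⟩
  lowerAll (V.map inject₁ π) , F.zero
    ≡⟨ cong (_, F.zero) (lowerAll-map-inject₁ π) ⟩
  π , F.zero ∎
  where open ≡-Reasoning
cycleRemove∘cycleInsert {n} π (F.suc a) =
  trans (cycleRemove-max-after σ a last≢max σa≡max unique)
        (cong (_, F.suc a) (trans (cong lowerAll restored) (lowerAll-map-inject₁ π)))
  where
  xs = V.map inject₁ π
  σ = cycleInsert π (F.suc a)
  init-σ : init σ ≡ xs [ a ]≔ fromℕ n
  init-σ = VP.init-∷ʳ (inject₁ (lookup π a)) (xs [ a ]≔ fromℕ n)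
  last-σ : last σ ≡ inject₁ (lookup π a)
  last-σ = VP.last-∷ʳ (inject₁ (lookup π a)) (xs [ a ]≔ fromℕ n)
  last≢max : last σ ≢ fromℕ n
  last≢max e = FinP.fromℕ≢inject₁ (trans (sym e) last-σ)
  σa≡max : lookup (init σ) a ≡ fromℕ n
  σa≡max = trans (cong (λ w → lookup w a) init-σ) (VP.lookup∘update a xs (fromℕ n))
  unique : ∀ b → lookup (init σ) b ≡ fromℕ n → b ≡ a
  unique b e with a FinP.≟ b
  ... | yes a≡b = sym a≡b
  ... | no a≢b  = ⊥-elim (FinP.fromℕ≢inject₁ (trans (sym e) (trans (lookup-init σ b) (cycleInsert-other π a b a≢b))))
  restored : init σ [ a ]≔ last σ ≡ xs
  restored = begin
    init σ [ a ]≔ last σ                         ≡⟨ cong₂ (λ w z → w [ a ]≔ z) init-σ last-σ ⟩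
    (xs [ a ]≔ fromℕ n) [ a ]≔ inject₁ (lookup π a) ≡⟨ VP.[]≔-idempotent xs a ⟩
    xs [ a ]≔ inject₁ (lookup π a)               ≡⟨ cong (xs [ a ]≔_) (sym (VP.lookup-map a inject₁ π)) ⟩
    xs [ a ]≔ lookup xs a                        ≡⟨ VP.[]≔-lookup xs a ⟩
    xs                                           ∎
    where open ≡-Reasoning

distinct-∷ʳ : ∀ {n m} (xs : Vec (Fin n) m) y → Distinct xs → (∀ k → lookup xs k ≢ y) → Distinct (xs ∷ʳ y)
distinct-∷ʳ xs y xs-distinct y∉xs p q e with inject₁-view p | inject₁-view q
... | inj₁ refl      | inj₁ refl      = refl
... | inj₁ refl      | inj₂ (l , refl) = ⊥-elim (y∉xs l (trans (sym (lookup-∷ʳ-inj xs y l)) (trans (sym e) (lookup-∷ʳ-top xs y))))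
... | inj₂ (k , refl) | inj₁ refl      = ⊥-elim (y∉xs k (trans (sym (lookup-∷ʳ-inj xs y k)) (trans e (lookup-∷ʳ-top xs y))))
... | inj₂ (k , refl) | inj₂ (l , refl) =
  cong inject₁ (xs-distinct k l (trans (sym (lookup-∷ʳ-inj xs y k)) (trans e (lookup-∷ʳ-inj xs y l))))

cycleInsert-distinct : ∀ {n} (π : Vec (Fin n) n) j → Distinct π → Distinct (cycleInsert π j)
cycleInsert-distinct {n} π F.zero    π-distinct = distinct-∷ʳ (V.map inject₁ π) (fromℕ n) lifted-distinct
  (λ k e → FinP.fromℕ≢inject₁ (trans (sym e) (VP.lookup-map k inject₁ π)))
  where
  lifted-distinct : Distinct (V.map inject₁ π)
  lifted-distinct k l e = π-distinct k l (FinP.inject₁-injective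
    (trans (sym (VP.lookup-map k inject₁ π)) (trans e (VP.lookup-map l inject₁ π))))
cycleInsert-distinct {n} π (F.suc a) π-distinct = distinct-∷ʳ xs (inject₁ (lookup π a)) xs-distinct πa∉xs
  where
  xs = V.map inject₁ π [ a ]≔ fromℕ n
  xs-a : lookup xs a ≡ fromℕ n
  xs-a = VP.lookup∘update a (V.map inject₁ π) (fromℕ n)
  xs-other : ∀ k → a ≢ k → lookup xs k ≡ inject₁ (lookup π k)
  xs-other k a≢k = trans (VP.lookup∘update′ (a≢k ∘ sym) (V.map inject₁ π) (fromℕ n)) (VP.lookup-map k inject₁ π)
  xs-distinct : Distinct xs
  xs-distinct k l e with a FinP.≟ k | a FinP.≟ l
  ... | yes refl | yes refl = refl
  ... | yes refl | no a≢l   = ⊥-elim (FinP.fromℕ≢inject₁ (trans (sym xs-a) (trans e (xs-other l a≢l))))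
  ... | no a≢k   | yes refl = ⊥-elim (FinP.fromℕ≢inject₁ (trans (sym xs-a) (trans (sym e) (xs-other k a≢k))))
  ... | no a≢k   | no a≢l   =
    π-distinct k l (FinP.inject₁-injective (trans (sym (xs-other k a≢k)) (trans e (xs-other l a≢l))))
  πa∉xs : ∀ k → lookup xs k ≢ inject₁ (lookup π a)
  πa∉xs k e with a FinP.≟ k
  ... | yes refl = FinP.fromℕ≢inject₁ (trans (sym xs-a) e)
  ... | no a≢k   = a≢k (π-distinct a k (FinP.inject₁-injective (trans (sym e) (xs-other k a≢k))))

module _ {n} (σ : Vec (Fin (suc n)) (suc n)) (σ-distinct : Distinct σ) where

  private
    Sound : Vec (Fin n) n × Fin (suc n) → Set
    Sound (π , j) = Distinct π × cycleInsert π j ≡ σ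

    init-distinct : Distinct (init σ)
    init-distinct a b e = FinP.inject₁-injective (σ-distinct _ _ (trans (sym (lookup-init σ a)) (trans e (lookup-init σ b))))

    max-fixed : last σ ≡ fromℕ n → Sound (cycleRemove σ)
    max-fixed σn≡n = subst Sound (sym (cycleRemove-max-fixed σ σn≡n)) (lowerAll-distinct (init σ) below-max init-distinct , σ≡)
      where
      below-max : ∀ k → lookup (init σ) k ≢ fromℕ n
      below-max k e =
        FinP.fromℕ≢inject₁ (sym (σ-distinct _ _ (trans (sym (lookup-init σ k)) (trans e (trans (sym σn≡n) (lookup-last σ))))))
      σ≡ : cycleInsert (lowerAll (init σ)) F.zero ≡ σ
      σ≡ = trans (cong₂ _∷ʳ_ (map-inject₁-lowerAll (init σ) below-max) (sym σn≡n)) (sym (init∷ʳlast σ))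

    max-after : ∀ a → last σ ≢ fromℕ n → lookup σ (inject₁ a) ≡ fromℕ n → Sound (cycleRemove σ)
    max-after a σn≢n σa≡n = subst Sound (sym (cycleRemove-max-after σ a σn≢n σa≡n′ unique))
      (lowerAll-distinct w below-max w-distinct , σ≡)
      where
      σa≡n′ : lookup (init σ) a ≡ fromℕ n
      σa≡n′ = trans (lookup-init σ a) σa≡n
      unique : ∀ b → lookup (init σ) b ≡ fromℕ n → b ≡ a
      unique b e = init-distinct b a (trans e (sym σa≡n′))
      w = init σ [ a ]≔ last σ
      w-a : lookup w a ≡ last σ
      w-a = VP.lookup∘update a (init σ) (last σ)
      w-other : ∀ k → a ≢ k → lookup w k ≡ lookup (init σ) k
      w-other k a≢k = VP.lookup∘update′ (a≢k ∘ sym) (init σ) (last σ)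
      below-max : ∀ k → lookup w k ≢ fromℕ n
      below-max k e with a FinP.≟ k
      ... | yes refl = σn≢n (trans (sym w-a) e)
      ... | no a≢k   = a≢k (sym (unique k (trans (sym (w-other k a≢k)) e)))
      last≢init : ∀ l → last σ ≢ lookup (init σ) l
      last≢init l e = FinP.fromℕ≢inject₁ (σ-distinct _ _ (trans (sym (lookup-last σ)) (trans e (lookup-init σ l))))
      w-distinct : Distinct w
      w-distinct k l e with a FinP.≟ k | a FinP.≟ l
      ... | yes refl | yes refl = refl
      ... | yes refl | no a≢l   = ⊥-elim (last≢init l (trans (sym w-a) (trans e (w-other l a≢l))))
      ... | no a≢k   | yes refl = ⊥-elim (last≢init k (trans (sym w-a) (trans (sym e) (w-other k a≢k))))
      ... | no a≢k   | no a≢l   = init-distinct k l (trans (sym (w-other k a≢k)) (trans e (w-other l a≢l)))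
      σ≡ : cycleInsert (lowerAll w) (F.suc a) ≡ σ
      σ≡ = begin
        (V.map inject₁ (lowerAll w) [ a ]≔ fromℕ n) ∷ʳ inject₁ (lookup (lowerAll w) a)
          ≡⟨ cong₂ (λ v z → (v [ a ]≔ fromℕ n) ∷ʳ z) (map-inject₁-lowerAll w below-max) (inject₁-lookup-lowerAll w below-max a) ⟩
        (w [ a ]≔ fromℕ n) ∷ʳ lookup w a
          ≡⟨ cong₂ _∷ʳ_ (VP.[]≔-idempotent (init σ) a) w-a ⟩
        (init σ [ a ]≔ fromℕ n) ∷ʳ last σ
          ≡⟨ cong (λ z → (init σ [ a ]≔ z) ∷ʳ last σ) (sym σa≡n′) ⟩
        (init σ [ a ]≔ lookup (init σ) a) ∷ʳ last σ
          ≡⟨ cong (_∷ʳ last σ) (VP.[]≔-lookup (init σ) a) ⟩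
        init σ ∷ʳ last σ
          ≡⟨ sym (init∷ʳlast σ) ⟩
        σ ∎
        where open ≡-Reasoning

  cycleRemove-correct : Distinct (proj₁ (cycleRemove σ)) × cycleInsert (proj₁ (cycleRemove σ)) (proj₂ (cycleRemove σ)) ≡ σ
  cycleRemove-correct = by-cases (last σ FinP.≟ fromℕ n) (preimage σ σ-distinct (fromℕ n))
    where
    by-cases : Dec (last σ ≡ fromℕ n) → (∃ λ p → lookup σ p ≡ fromℕ n) → Sound (cycleRemove σ)
    by-cases (yes σn≡n) _ = max-fixed σn≡n
    by-cases (no σn≢n) (p , σp≡n) with inject₁-view p
    ... | inj₁ refl       = ⊥-elim (σn≢n (trans (lookup-last σ) σp≡n))
    ... | inj₂ (a , refl) = max-after a σn≢n σp≡n

∑-one : ∀ n → ∑[ i < n ] 1 ≡ n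
∑-one zero    = refl
∑-one (suc n) = cong suc (∑-one n)

∑-distrib-+₅ : ∀ {n} (f g h k l : Fin n → ℕ) →
               ∑[ i < n ] (f i + g i + h i + k i + l i) ≡ sum f + sum g + sum h + sum k + sum l
∑-distrib-+₅ f g h k l =
  trans (∑-distrib-+ (λ i → f i + g i + h i + k i) l) (cong (_+ sum l)
  (trans (∑-distrib-+ (λ i → f i + g i + h i) k) (cong (_+ sum k)
  (trans (∑-distrib-+ (λ i → f i + g i) h) (cong (_+ sum h) (∑-distrib-+ f g))))))

listInsert : ∀ {a} {A : Set a} → ℕ → A → List A → List A
listInsert zero    m xs       = m ∷ xs
listInsert (suc j) m []       = m ∷ []
listInsert (suc j) m (x ∷ xs) = x ∷ listInsert j m xs

module _ (a b c : ℕ) where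

  isPeak-yes : a < b → c < b → isPeak a b c ≡ 1
  isPeak-yes a<b c<b with a <? b | c <? b
  ... | yes _ | yes _   = refl
  ... | yes _ | no c≮b  = ⊥-elim (c≮b c<b)
  ... | no a≮b | _      = ⊥-elim (a≮b a<b)

  isPeak-noˡ : ¬ a < b → isPeak a b c ≡ 0
  isPeak-noˡ a≮b with a <? b
  ... | yes a<b = ⊥-elim (a≮b a<b)
  ... | no _    = refl

  isPeak-noʳ : ¬ c < b → isPeak a b c ≡ 0
  isPeak-noʳ c≮b with a <? b | c <? b
  ... | yes _ | yes c<b = ⊥-elim (c≮b c<b)
  ... | yes _ | no _    = refl
  ... | no _  | _       = refl

  isPeak≡0⊎1 : isPeak a b c ≡ 0 ⊎ isPeak a b c ≡ 1
  isPeak≡0⊎1 with a <? b | c <? b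
  ... | yes _ | yes _ = inj₂ refl
  ... | yes _ | no _  = inj₁ refl
  ... | no _  | _     = inj₁ refl

  isPeak≡1⇒>ʳ : isPeak a b c ≡ 1 → c < b
  isPeak≡1⇒>ʳ eq with a <? b | c <? b
  ... | yes _ | yes c<b = c<b
  ... | yes _ | no _    = ⊥-elim (0≢1+n eq)
  ... | no _  | _       = ⊥-elim (0≢1+n eq)

peakAt : ℕ → ℕ → List ℕ → ℕ
peakAt a x []      = 0
peakAt a x (y ∷ _) = isPeak a x y

peaks-∷ : ∀ a x r → peaks (a ∷ x ∷ r) ≡ peakAt a x r + peaks (x ∷ r)
peaks-∷ a x []      = refl
peaks-∷ a x (y ∷ r) = refl

peakAt-noˡ : ∀ a x r → ¬ a < x → peakAt a x r ≡ 0
peakAt-noˡ a x []      _   = refl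
peakAt-noˡ a x (y ∷ r) a≮x = isPeak-noˡ a x y a≮x

peakAt≡0⊎1 : ∀ a x r → peakAt a x r ≡ 0 ⊎ peakAt a x r ≡ 1
peakAt≡0⊎1 a x []      = inj₁ refl
peakAt≡0⊎1 a x (y ∷ r) = isPeak≡0⊎1 a x y

peaksInserting : ℕ → ℕ → List ℕ → ℕ → ℕ
peaksInserting M a w j = peaks (a ∷ listInsert j M w)

𝟙-dichotomy : ∀ {x p} → x ≡ p ⊎ x ≡ suc p → 𝟙 (x ≟ p) + 𝟙 (x ≟ suc p) ≡ 1
𝟙-dichotomy {p = p} (inj₁ refl) rewrite 𝟙-yes (p ≟ p) refl | 𝟙-no (p ≟ suc p) (λ e → 1+n≢n (sym e)) = refl
𝟙-dichotomy {p = p} (inj₂ refl) rewrite 𝟙-no (suc p ≟ p) (1+n≢n {p}) | 𝟙-yes (suc p ≟ suc p) refl = refl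

𝟙-dichotomy-split : ∀ {x p} k → x ≡ p ⊎ x ≡ suc p →
                    𝟙 (x ≟ k) ≡ 𝟙 (p ≟ k) * 𝟙 (x ≟ p) + 𝟙 (suc p ≟ k) * 𝟙 (x ≟ suc p)
𝟙-dichotomy-split {p = p} k (inj₁ refl) rewrite 𝟙-yes (p ≟ p) refl | 𝟙-no (p ≟ suc p) (λ e → 1+n≢n (sym e)) =
  sym (trans (cong₂ _+_ (*-identityʳ _) (*-zeroʳ (𝟙 (suc p ≟ k)))) (+-identityʳ _))
𝟙-dichotomy-split {p = p} k (inj₂ refl) rewrite 𝟙-no (suc p ≟ p) (1+n≢n {p}) | 𝟙-yes (suc p ≟ suc p) refl =
  sym (cong₂ _+_ (*-zeroʳ (𝟙 (p ≟ k))) (*-identityʳ _))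

module Inserting (M : ℕ) where

  private
    D = peaksInserting M

  insert-front : ∀ a x r → a < M → x < M → D a (x ∷ r) 0 ≡ suc (peaks (x ∷ r))
  insert-front a x r a<M x<M =
    cong₂ _+_ (isPeak-yes a M x a<M x<M) (trans (peaks-∷ M x r) (cong (_+ peaks (x ∷ r)) (M-no-peak r)))
    where
    M-no-peak : ∀ r → peakAt M x r ≡ 0
    M-no-peak []      = refl
    M-no-peak (y ∷ r) = isPeak-noˡ M x y (<-asym x<M)

  module NoPeak (a x : ℕ) (r : List ℕ) (x<M : x < M) (no-peak : peakAt a x r ≡ 0) where

    peaks-same : peaks (a ∷ x ∷ r) ≡ peaks (x ∷ r)
    peaks-same = trans (peaks-∷ a x r) (cong (_+ peaks (x ∷ r)) no-peak)

    insert-later : ∀ j → D a (x ∷ r) (suc j) ≡ D x r j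
    insert-later j = trans (peaks-∷ a x (listInsert j M r)) (cong (_+ D x r j) (no-peak-after-insert r j no-peak))
      where
      no-peak-after-insert : ∀ r j → peakAt a x r ≡ 0 → peakAt a x (listInsert j M r) ≡ 0
      no-peak-after-insert r       zero    _ = isPeak-noʳ a x M (<-asym x<M)
      no-peak-after-insert []      (suc j) _ = isPeak-noʳ a x M (<-asym x<M)
      no-peak-after-insert (y ∷ r) (suc j) h = h

  module Peak (a x y : ℕ) (r : List ℕ) (a<M : a < M) (x<M : x < M) (y<M : y < M)
              (peak : isPeak a x y ≡ 1) where

    private
      q = peaks (x ∷ y ∷ r)

    peaks-one-more : peaks (a ∷ x ∷ y ∷ r) ≡ suc q
    peaks-one-more = cong (_+ q) peak

    insert-front′ : D x (y ∷ r) 0 ≡ suc q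
    insert-front′ = trans (insert-front x y r x<M y<M) (cong suc (sym (trans (peaks-∷ x y r)
      (cong (_+ peaks (y ∷ r)) (peakAt-noˡ x y r (<-asym (isPeak≡1⇒>ʳ a x y peak)))))))

    insert-second : D a (x ∷ y ∷ r) 1 ≡ suc q
    insert-second = trans (cong (_+ D x (y ∷ r) 0) (isPeak-noʳ a x M (<-asym x<M))) insert-front′

    insert-later : ∀ j → D a (x ∷ y ∷ r) (suc (suc j)) ≡ suc (D x (y ∷ r) (suc j))
    insert-later j = cong (_+ D x (y ∷ r) (suc j)) peak

  insertion-step : ∀ a w → All (_< M) (a ∷ w) → (j : Fin (suc (length w))) →
                   D a w (toℕ j) ≡ peaks (a ∷ w) ⊎ D a w (toℕ j) ≡ suc (peaks (a ∷ w))
  insertion-step a []      _                  F.zero = inj₁ refl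
  insertion-step a (x ∷ r) (a<M ∷ x<M ∷ r<M) j with peakAt≡0⊎1 a x r
  ... | inj₁ no-peak with j
  ...   | F.zero  = inj₂ (trans (insert-front a x r a<M x<M) (cong suc (sym peaks-same)))
    where open NoPeak a x r x<M no-peak
  ...   | F.suc j with insertion-step x r (x<M ∷ r<M) j
  ...     | inj₁ e = inj₁ (trans (insert-later (toℕ j)) (trans e (sym peaks-same)))
    where open NoPeak a x r x<M no-peak
  ...     | inj₂ e = inj₂ (trans (insert-later (toℕ j)) (trans e (cong suc (sym peaks-same))))
    where open NoPeak a x r x<M no-peak
  insertion-step a (x ∷ []) _ j | inj₂ ()
  insertion-step a (x ∷ y ∷ r) (a<M ∷ x<M ∷ y<M ∷ r<M) F.zero | inj₂ peak =
    inj₁ (trans (insert-front a x (y ∷ r) a<M x<M) (sym (Peak.peaks-one-more a x y r a<M x<M y<M peak)))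
  insertion-step a (x ∷ y ∷ r) (a<M ∷ x<M ∷ y<M ∷ r<M) (F.suc F.zero) | inj₂ peak =
    inj₁ (trans insert-second (sym peaks-one-more))
    where open Peak a x y r a<M x<M y<M peak
  insertion-step a (x ∷ y ∷ r) (a<M ∷ x<M ∷ y<M ∷ r<M) (F.suc (F.suc j)) | inj₂ peak
    with insertion-step x (y ∷ r) (x<M ∷ y<M ∷ r<M) (F.suc j)
  ... | inj₁ e = inj₁ (trans (insert-later (toℕ j)) (trans (cong suc e) (sym peaks-one-more)))
    where open Peak a x y r a<M x<M y<M peak
  ... | inj₂ e = inj₂ (trans (insert-later (toℕ j)) (cong suc (trans e (sym peaks-one-more))))
    where open Peak a x y r a<M x<M y<M peak

  -- M keeps the number of peaks exactly when it lands right before or after a peak, or at the end.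
  insertion-count : ∀ a w → All (_< M) (a ∷ w) →
                    ∑[ j < suc (length w) ] 𝟙 (D a w (toℕ j) ≟ peaks (a ∷ w)) ≡ suc (2 * peaks (a ∷ w))
  insertion-count a []      _ = refl
  insertion-count a (x ∷ r) (a<M ∷ x<M ∷ r<M) with peakAt≡0⊎1 a x r
  ... | inj₁ no-peak = begin
    𝟙 (D a (x ∷ r) 0 ≟ p) + ∑[ j < suc (length r) ] 𝟙 (D a (x ∷ r) (suc (toℕ j)) ≟ p)
      ≡⟨ cong₂ _+_ (𝟙-no (_ ≟ p) (λ e → 1+n≢n (trans (sym (insert-front a x r a<M x<M)) (trans e peaks-same))))
                   (sum-cong-≗ {suc (length r)} (λ j → cong (λ z → 𝟙 (z ≟ p)) (insert-later (toℕ j)))) ⟩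
    ∑[ j < suc (length r) ] 𝟙 (D x r (toℕ j) ≟ p)
      ≡⟨ subst (λ q → ∑[ j < suc (length r) ] 𝟙 (D x r (toℕ j) ≟ q) ≡ suc (2 * q)) (sym peaks-same)
               (insertion-count x r (x<M ∷ r<M)) ⟩
    suc (2 * p) ∎
    where
    open ≡-Reasoning
    open NoPeak a x r x<M no-peak
    p = peaks (a ∷ x ∷ r)
  insertion-count a (x ∷ []) _ | inj₂ ()
  insertion-count a (x ∷ y ∷ r) (a<M ∷ x<M ∷ y<M ∷ r<M) | inj₂ peak = begin
    𝟙 (D a w 0 ≟ p) + (𝟙 (D a w 1 ≟ p) + ∑[ j < suc (length r) ] 𝟙 (D a w (suc (suc (toℕ j))) ≟ p))
      ≡⟨ cong₂ (λ u v → u + (v + ∑[ j < suc (length r) ] 𝟙 (D a w (suc (suc (toℕ j))) ≟ p)))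
               (𝟙-yes (_ ≟ p) (trans (insert-front a x (y ∷ r) a<M x<M) (sym peaks-one-more)))
               (𝟙-yes (_ ≟ p) (trans insert-second (sym peaks-one-more))) ⟩
    2 + ∑[ j < suc (length r) ] 𝟙 (D a w (suc (suc (toℕ j))) ≟ p)
      ≡⟨ cong (2 +_) (sum-cong-≗ {suc (length r)} (λ j → trans (cong (λ z → 𝟙 (z ≟ p)) (insert-later (toℕ j)))
                                              (cong (λ z → 𝟙 (suc (D x (y ∷ r) (suc (toℕ j))) ≟ z)) peaks-one-more))) ⟩
    2 + ∑[ j < suc (length r) ] 𝟙 (D x (y ∷ r) (suc (toℕ j)) ≟ q)
      ≡⟨ cong (2 +_) (trans (cong (_+ rest) (sym first-term)) (insertion-count x (y ∷ r) (x<M ∷ y<M ∷ r<M))) ⟩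
    2 + suc (2 * q)
      ≡⟨ cong suc (sym (*-suc 2 q)) ⟩
    suc (2 * suc q)
      ≡⟨ cong (λ z → suc (2 * z)) (sym peaks-one-more) ⟩
    suc (2 * p) ∎
    where
    open ≡-Reasoning
    open Peak a x y r a<M x<M y<M peak
    w = x ∷ y ∷ r
    p = peaks (a ∷ w)
    q = peaks (x ∷ y ∷ r)
    rest = ∑[ j < suc (length r) ] 𝟙 (D x (y ∷ r) (suc (toℕ j)) ≟ q)
    first-term : 𝟙 (D x (y ∷ r) 0 ≟ q) ≡ 0
    first-term = 𝟙-no (_ ≟ q) (λ e → 1+n≢n (trans (sym insert-front′) e))

  insertion-distribution : ∀ a w k → All (_< M) (a ∷ w) →
    ∑[ j < suc (length w) ] 𝟙 (D a w (toℕ j) ≟ k)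
      ≡ 𝟙 (peaks (a ∷ w) ≟ k) * suc (2 * peaks (a ∷ w)) + 𝟙 (suc (peaks (a ∷ w)) ≟ k) * (length w ∸ 2 * peaks (a ∷ w))
  insertion-distribution a w k w<M = begin
    ∑[ j < suc L ] 𝟙 (D a w (toℕ j) ≟ k)
      ≡⟨ sum-cong-≗ {suc L} (λ j → 𝟙-dichotomy-split k (step j)) ⟩
    ∑[ j < suc L ] (𝟙 (p ≟ k) * same j + 𝟙 (suc p ≟ k) * more j)
      ≡⟨ ∑-distrib-+ (λ j → 𝟙 (p ≟ k) * same j) (λ j → 𝟙 (suc p ≟ k) * more j) ⟩
    ∑[ j < suc L ] (𝟙 (p ≟ k) * same j) + ∑[ j < suc L ] (𝟙 (suc p ≟ k) * more j)
      ≡⟨ sym (cong₂ _+_ (*-distribˡ-sum (𝟙 (p ≟ k)) same) (*-distribˡ-sum (𝟙 (suc p ≟ k)) more)) ⟩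
    𝟙 (p ≟ k) * ∑[ j < suc L ] same j + 𝟙 (suc p ≟ k) * ∑[ j < suc L ] more j
      ≡⟨ cong₂ (λ u v → 𝟙 (p ≟ k) * u + 𝟙 (suc p ≟ k) * v) (insertion-count a w w<M) ∑more ⟩
    𝟙 (p ≟ k) * suc (2 * p) + 𝟙 (suc p ≟ k) * (L ∸ 2 * p) ∎
    where
    open ≡-Reasoning
    L = length w
    p = peaks (a ∷ w)
    step = insertion-step a w w<M
    same more : Fin (suc L) → ℕ
    same j = 𝟙 (D a w (toℕ j) ≟ p)
    more j = 𝟙 (D a w (toℕ j) ≟ suc p)
    ∑more : ∑[ j < suc L ] more j ≡ L ∸ 2 * p
    ∑more = begin
      ∑[ j < suc L ] more j                              ≡⟨ sym (m+n∸m≡n (suc (2 * p)) _) ⟩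
      suc (2 * p) + ∑[ j < suc L ] more j ∸ suc (2 * p)
        ≡⟨ cong (λ z → z + ∑[ j < suc L ] more j ∸ suc (2 * p)) (sym (insertion-count a w w<M)) ⟩
      ∑[ j < suc L ] same j + ∑[ j < suc L ] more j ∸ suc (2 * p)
        ≡⟨ cong (_∸ suc (2 * p)) (trans (sym (∑-distrib-+ same more))
                                        (trans (sum-cong-≗ {suc L} (𝟙-dichotomy ∘ step)) (∑-one (suc L)))) ⟩
      L ∸ 2 * p ∎

lpkNumber : ℕ → ℕ → ℕ
lpkNumber zero    zero    = 1
lpkNumber zero    (suc k) = 0
lpkNumber (suc n) zero    = lpkNumber n zero
lpkNumber (suc n) (suc k) = suc (2 * suc k) * lpkNumber n (suc k) + (n ∸ 2 * k) * lpkNumber n k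

Statistic : Set
Statistic = ∀ {n} → Vec (Fin n) n → ℕ

count : Statistic → ℕ → ℕ → ℕ
count st n k = ∑[ π ∈ S n ] 𝟙 (st π ≟ k)

InsertionRule : Statistic → Set
InsertionRule st = ∀ n k →
  count st (suc n) k ≡ ∑[ π ∈ S n ] (𝟙 (st π ≟ k) * suc (2 * st π) + 𝟙 (suc (st π) ≟ k) * (n ∸ 2 * st π))

count≡lpkNumber : (st : Statistic) → st [] ≡ 0 → InsertionRule st → ∀ n k → count st n k ≡ lpkNumber n k
count≡lpkNumber st st[]≡0 rule zero k rewrite st[]≡0 with k
... | zero  = refl
... | suc _ = refl
count≡lpkNumber st st[]≡0 rule (suc n) k =
  trans (rule n k) (trans (∑∈-distrib-+ (S n) _ _) (split k))
  where
  IH = count≡lpkNumber st st[]≡0 rule n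

  keep : ∀ k → ∑[ π ∈ S n ] (𝟙 (st π ≟ k) * suc (2 * st π)) ≡ suc (2 * k) * lpkNumber n k
  keep k = begin
    ∑[ π ∈ S n ] (𝟙 (st π ≟ k) * suc (2 * st π))
      ≡⟨ ∑∈-cong (S n) (λ π _ → trans (𝟙≟-* (st π) k (λ s → suc (2 * s))) (*-comm (𝟙 (st π ≟ k)) (suc (2 * k)))) ⟩
    ∑[ π ∈ S n ] (suc (2 * k) * 𝟙 (st π ≟ k))      ≡⟨ *-distribˡ-∑∈ (S n) (suc (2 * k)) _ ⟩
    suc (2 * k) * count st n k                     ≡⟨ cong (suc (2 * k) *_) (IH k) ⟩
    suc (2 * k) * lpkNumber n k                    ∎
    where open ≡-Reasoning

  raise : ∀ k → ∑[ π ∈ S n ] (𝟙 (suc (st π) ≟ suc k) * (n ∸ 2 * st π)) ≡ (n ∸ 2 * k) * lpkNumber n k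
  raise k = begin
    ∑[ π ∈ S n ] (𝟙 (suc (st π) ≟ suc k) * (n ∸ 2 * st π))
      ≡⟨ ∑∈-cong (S n) (λ π _ → trans (𝟙≟-* (st π) k (λ s → n ∸ 2 * s)) (*-comm (𝟙 (st π ≟ k)) (n ∸ 2 * k))) ⟩
    ∑[ π ∈ S n ] ((n ∸ 2 * k) * 𝟙 (st π ≟ k))   ≡⟨ *-distribˡ-∑∈ (S n) (n ∸ 2 * k) _ ⟩
    (n ∸ 2 * k) * count st n k                  ≡⟨ cong ((n ∸ 2 * k) *_) (IH k) ⟩
    (n ∸ 2 * k) * lpkNumber n k                 ∎
    where open ≡-Reasoning

  split : ∀ k → ∑[ π ∈ S n ] (𝟙 (st π ≟ k) * suc (2 * st π)) + ∑[ π ∈ S n ] (𝟙 (suc (st π) ≟ k) * (n ∸ 2 * st π))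
              ≡ lpkNumber (suc n) k
  split zero    = trans (cong₂ _+_ (keep 0) (∑∈-zero (S n))) (trans (+-identityʳ _) (+-identityʳ _))
  split (suc k) = cong₂ _+_ (keep (suc k)) (raise k)

entries : ∀ {m k} → Vec (Fin m) k → List ℕ
entries v = L.map (λ a → suc (toℕ a)) (toList v)

entries-insertAt : ∀ {m k} (xs : Vec (Fin m) k) j v →
                   entries (insertAt xs j v) ≡ listInsert (toℕ j) (suc (toℕ v)) (entries xs)
entries-insertAt xs       F.zero    v = refl
entries-insertAt (x ∷ xs) (F.suc j) v = cong (suc (toℕ x) ∷_) (entries-insertAt xs j v)

entries-map-inject₁ : ∀ {m k} (xs : Vec (Fin m) k) → entries (V.map inject₁ xs) ≡ entries xs
entries-map-inject₁ []       = refl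
entries-map-inject₁ (x ∷ xs) = cong₂ _∷_ (cong suc (FinP.toℕ-inject₁ x)) (entries-map-inject₁ xs)

length-entries : ∀ {m k} (xs : Vec (Fin m) k) → length (entries xs) ≡ k
length-entries []       = refl
length-entries (x ∷ xs) = cong suc (length-entries xs)

entries-< : ∀ {m k} (xs : Vec (Fin m) k) → All (_< suc m) (entries xs)
entries-< []       = []
entries-< (x ∷ xs) = s≤s (FinP.toℕ<n x) ∷ entries-< xs

lpk-lineInsert : ∀ {n} (π : Vec (Fin n) n) j → lpk (lineInsert π j) ≡ peaksInserting (suc n) 0 (values π) (toℕ j)
lpk-lineInsert {n} π j = cong (λ w → peaks (0 ∷ w)) (begin
  entries (insertAt (V.map inject₁ π) j (fromℕ n))                   ≡⟨ entries-insertAt (V.map inject₁ π) j (fromℕ n) ⟩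
  listInsert (toℕ j) (suc (toℕ (fromℕ n))) (entries (V.map inject₁ π)) ≡⟨ cong₂ (λ a w → listInsert (toℕ j) (suc a) w)
                                                                           (FinP.toℕ-fromℕ n) (entries-map-inject₁ π) ⟩
  listInsert (toℕ j) (suc n) (values π)                              ∎)
  where open ≡-Reasoning

∑-S-suc-lineInsert : ∀ n (h : Vec (Fin (suc n)) (suc n) → ℕ) →
                     ∑[ σ ∈ S (suc n) ] h σ ≡ ∑[ π ∈ S n ] (∑[ j < suc n ] h (lineInsert π j))
∑-S-suc-lineInsert n = Enumeration.∑-S-suc lineInsert lineRemove lineRemove∘lineInsert
  lineInsert-distinct lineRemove-distinct lineInsert∘lineRemove

lpk-insertionRule : InsertionRule lpk
lpk-insertionRule n k = trans (∑-S-suc-lineInsert n _) (∑∈-cong (S n) (λ π _ → begin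
  ∑[ j < suc n ] 𝟙 (lpk (lineInsert π j) ≟ k)
    ≡⟨ sum-cong-≗ {suc n} (λ j → cong (λ z → 𝟙 (z ≟ k)) (lpk-lineInsert π j)) ⟩
  ∑[ j < suc n ] 𝟙 (peaksInserting (suc n) 0 (values π) (toℕ j) ≟ k)
    ≡⟨ subst (λ L → ∑[ j < suc L ] 𝟙 (peaksInserting (suc n) 0 (values π) (toℕ j) ≟ k)
                  ≡ 𝟙 (lpk π ≟ k) * suc (2 * lpk π) + 𝟙 (suc (lpk π) ≟ k) * (L ∸ 2 * lpk π))
             (length-entries π)
             (Inserting.insertion-distribution (suc n) 0 (values π) k (z<s ∷ entries-< π)) ⟩
  𝟙 (lpk π ≟ k) * suc (2 * lpk π) + 𝟙 (suc (lpk π) ≟ k) * (n ∸ 2 * lpk π) ∎))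
  where open ≡-Reasoning

lpkCoeff≡lpkNumber : ∀ n k → lpkCoeff n k ≡ lpkNumber n k
lpkCoeff≡lpkNumber n k = trans (length-filter (λ π → lpk π ≟ k) (S n)) (count≡lpkNumber lpk refl lpk-insertionRule n k)

-- Whether the cycle predecessor π⁻¹(i) and the cycle successor π(i) of i lie below or above i; cval, cpk, cda, cdd count
-- cycle valleys, peaks, double ascents and double descents (CDA π i of the definitions is PredBelow × ascent).
module _ {n : ℕ} (π : Vec (Fin n) n) where

  PredBelow PredAbove : Fin n → Set
  PredBelow i = Σ (Fin n) λ j → (lookup π j ≡ i) × (toℕ j < toℕ i)
  PredAbove i = Σ (Fin n) λ j → (lookup π j ≡ i) × (toℕ i < toℕ j)

  predBelow? : ∀ i → Dec (PredBelow i)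
  predBelow? i = FinP.any? (λ j → (lookup π j FinP.≟ i) ×-dec (toℕ j <? toℕ i))

  predAbove? : ∀ i → Dec (PredAbove i)
  predAbove? i = FinP.any? (λ j → (lookup π j FinP.≟ i) ×-dec (toℕ i <? toℕ j))

  succAbove? : ∀ i → Dec (toℕ i < toℕ (lookup π i))
  succAbove? i = toℕ i <? toℕ (lookup π i)

  succBelow? : ∀ i → Dec (toℕ (lookup π i) < toℕ i)
  succBelow? i = toℕ (lookup π i) <? toℕ i

  fixed? : ∀ i → Dec (toℕ (lookup π i) ≡ toℕ i)
  fixed? i = toℕ (lookup π i) ≟ toℕ i

  predBelow predAbove succAbove succBelow fixed : Fin n → ℕ
  predBelow = 𝟙 ∘ predBelow?
  predAbove = 𝟙 ∘ predAbove?
  succAbove = 𝟙 ∘ succAbove?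
  succBelow = 𝟙 ∘ succBelow?
  fixed     = 𝟙 ∘ fixed?

  cval cpk cda cdd cfix : ℕ
  cval = ∑[ i < n ] (predAbove i * succAbove i)
  cpk  = ∑[ i < n ] (predBelow i * succBelow i)
  cda  = ∑[ i < n ] (predBelow i * succAbove i)
  cdd  = ∑[ i < n ] (predAbove i * succBelow i)
  cfix = ∑[ i < n ] fixed i

one-of-three : ∀ x y z → x + y + z ≡ 1 → (x ≡ 1 × y ≡ 0 × z ≡ 0) ⊎ (x ≡ 0 × ((y ≡ 1 × z ≡ 0) ⊎ (y ≡ 0 × z ≡ 1)))
one-of-three 0       0       1       refl = inj₂ (refl , inj₂ (refl , refl))
one-of-three 0       1       0       refl = inj₂ (refl , inj₁ (refl , refl))
one-of-three 1       0       0       refl = inj₁ (refl , refl , refl)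
one-of-three 0       0       (suc (suc _)) ()
one-of-three 0       1       (suc _) ()
one-of-three 0       (suc (suc _)) _ ()
one-of-three 1       0       (suc _) ()
one-of-three 1       (suc _) _ ()
one-of-three (suc (suc _)) _ _ ()
one-of-three 0       0       0       ()

-- Pointwise forms of cval + cda = exc, cpk + cda = #{i : π⁻¹(i) < i} and cfix + cval + cpk + cdd + cda = n, where
-- f/u/d say that a point is fixed/ascends/descends and b/a that it is entered from below/above.
two-partitions : ∀ f u d b a → f + u + d ≡ 1 → f + b + a ≡ 1 →
                 (a * u + b * u ≡ u) × (b * d + b * u ≡ b) × (f + a * u + b * d + a * d + b * u ≡ 1)
two-partitions f u d b a fud bfa with one-of-three f u d fud | one-of-three f b a bfa
... | inj₁ (refl , refl , refl)          | inj₁ (_ , refl , refl)           = refl , refl , refl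
... | inj₁ (refl , _)                    | inj₂ (() , _)
... | inj₂ (refl , _)                    | inj₁ (() , _)
... | inj₂ (refl , inj₁ (refl , refl))   | inj₂ (_ , inj₁ (refl , refl))    = refl , refl , refl
... | inj₂ (refl , inj₁ (refl , refl))   | inj₂ (_ , inj₂ (refl , refl))    = refl , refl , refl
... | inj₂ (refl , inj₂ (refl , refl))   | inj₂ (_ , inj₁ (refl , refl))    = refl , refl , refl
... | inj₂ (refl , inj₂ (refl , refl))   | inj₂ (_ , inj₂ (refl , refl))    = refl , refl , refl

fixed+succAbove+succBelow≡1 : ∀ {n} (π : Vec (Fin n) n) i → fixed π i + succAbove π i + succBelow π i ≡ 1
fixed+succAbove+succBelow≡1 π i with <-cmp (toℕ i) (toℕ (lookup π i))
... | tri< i<πi i≢πi _ rewrite 𝟙-no (fixed? π i) (i≢πi ∘ sym) | 𝟙-yes (succAbove? π i) i<πi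
                             | 𝟙-no (succBelow? π i) (<-asym i<πi) = refl
... | tri≈ _ i≡πi _    rewrite 𝟙-yes (fixed? π i) (sym i≡πi) | 𝟙-no (succAbove? π i) (<-irrefl i≡πi)
                             | 𝟙-no (succBelow? π i) (<-irrefl (sym i≡πi)) = refl
... | tri> _ i≢πi πi<i rewrite 𝟙-no (fixed? π i) (i≢πi ∘ sym) | 𝟙-no (succAbove? π i) (<-asym πi<i)
                             | 𝟙-yes (succBelow? π i) πi<i = refl

module _ {n : ℕ} (π : Vec (Fin n) n) (π-distinct : Distinct π) where

  predBelow∘π≡succAbove : ∀ a → predBelow π (lookup π a) ≡ succAbove π a
  predBelow∘π≡succAbove a = 𝟙-⇔ (predBelow? π (lookup π a)) (succAbove? π a)
    (λ { (j , πj≡πa , j<πa) → subst (λ z → toℕ z < toℕ (lookup π a)) (π-distinct j a πj≡πa) j<πa })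
    (λ a<πa → a , refl , a<πa)

  predAbove∘π≡succBelow : ∀ a → predAbove π (lookup π a) ≡ succBelow π a
  predAbove∘π≡succBelow a = 𝟙-⇔ (predAbove? π (lookup π a)) (succBelow? π a)
    (λ { (j , πj≡πa , πa<j) → subst (λ z → toℕ (lookup π a) < toℕ z) (π-distinct j a πj≡πa) πa<j })
    (λ πa<a → a , refl , πa<a)

  fixed∘π≡fixed : ∀ a → fixed π (lookup π a) ≡ fixed π a
  fixed∘π≡fixed a = 𝟙-⇔ (fixed? π (lookup π a)) (fixed? π a)
    (λ e → cong toℕ (π-distinct _ _ (FinP.toℕ-injective e)))
    (λ e → cong (toℕ ∘ lookup π) (FinP.toℕ-injective e))

  fixed+predBelow+predAbove≡1 : ∀ i → fixed π i + predBelow π i + predAbove π i ≡ 1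
  fixed+predBelow+predAbove≡1 i with preimage π π-distinct i
  ... | a , refl rewrite fixed∘π≡fixed a | predBelow∘π≡succAbove a | predAbove∘π≡succBelow a =
    fixed+succAbove+succBelow≡1 π a

  private
    partitions : ∀ i → _
    partitions i = two-partitions (fixed π i) (succAbove π i) (succBelow π i) (predBelow π i) (predAbove π i)
                     (fixed+succAbove+succBelow≡1 π i) (fixed+predBelow+predAbove≡1 i)

  cval+cda≡∑succAbove : cval π + cda π ≡ ∑[ i < n ] succAbove π i
  cval+cda≡∑succAbove = trans (sym (∑-distrib-+ (λ i → predAbove π i * succAbove π i) (λ i → predBelow π i * succAbove π i)))
                              (sum-cong-≗ {n} (proj₁ ∘ partitions))

  cpk≡cval : cpk π ≡ cval π
  cpk≡cval = +-cancelʳ-≡ (cda π) (cpk π) (cval π) (begin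
    cpk π + cda π               ≡⟨ sym (∑-distrib-+ (λ i → predBelow π i * succBelow π i) (λ i → predBelow π i * succAbove π i)) ⟩
    ∑[ i < n ] (predBelow π i * succBelow π i + predBelow π i * succAbove π i)
                                ≡⟨ sum-cong-≗ {n} (proj₁ ∘ proj₂ ∘ partitions) ⟩
    ∑[ i < n ] predBelow π i     ≡⟨ sym (∑-reindex π π-distinct (predBelow π)) ⟩
    ∑[ i < n ] predBelow π (lookup π i) ≡⟨ sum-cong-≗ {n} predBelow∘π≡succAbove ⟩
    ∑[ i < n ] succAbove π i     ≡⟨ sym cval+cda≡∑succAbove ⟩
    cval π + cda π              ∎)
    where open ≡-Reasoning

  cfix+2cval+cdd+cda≡n : cfix π + 2 * cval π + cdd π + cda π ≡ n
  cfix+2cval+cdd+cda≡n = begin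
    cfix π + 2 * cval π + cdd π + cda π           ≡⟨ cong (λ z → cfix π + (cval π + z) + cdd π + cda π) (+-identityʳ (cval π)) ⟩
    cfix π + (cval π + cval π) + cdd π + cda π    ≡⟨ cong (λ z → cfix π + (cval π + z) + cdd π + cda π) (sym cpk≡cval) ⟩
    cfix π + (cval π + cpk π) + cdd π + cda π     ≡⟨ cong (λ z → z + cdd π + cda π) (sym (+-assoc (cfix π) _ _)) ⟩
    cfix π + cval π + cpk π + cdd π + cda π       ≡⟨ sym (∑-distrib-+₅ (fixed π) (λ i → predAbove π i * succAbove π i)
                                                       (λ i → predBelow π i * succBelow π i) (λ i → predAbove π i * succBelow π i)
                                                       (λ i → predBelow π i * succAbove π i)) ⟩
    ∑[ i < n ] (fixed π i + predAbove π i * succAbove π i + predBelow π i * succBelow π i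
                + predAbove π i * succBelow π i + predBelow π i * succAbove π i)
                                                   ≡⟨ sum-cong-≗ {n} (proj₂ ∘ proj₂ ∘ partitions) ⟩
    ∑[ i < n ] 1                                   ≡⟨ ∑-one n ⟩
    n                                              ∎
    where open ≡-Reasoning

inject₁<fromℕ : ∀ {n} (k : Fin n) → toℕ (inject₁ k) < toℕ (fromℕ n)
inject₁<fromℕ {n} k = subst₂ _<_ (sym (FinP.toℕ-inject₁ k)) (sym (FinP.toℕ-fromℕ n)) (FinP.toℕ<n k)

fromℕ≮ : ∀ {n} (i : Fin (suc n)) → ¬ toℕ (fromℕ n) < toℕ i
fromℕ≮ {n} i n<i = <⇒≱ n<i (subst (toℕ i ≤_) (sym (FinP.toℕ-fromℕ n)) (s≤s⁻¹ (FinP.toℕ<n i)))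

module _ {n : ℕ} (σ : Vec (Fin (suc n)) (suc n)) (π : Vec (Fin n) n) where

  succAbove-lift : ∀ k → lookup σ (inject₁ k) ≡ inject₁ (lookup π k) → succAbove σ (inject₁ k) ≡ succAbove π k
  succAbove-lift k σk≡πk = 𝟙-⇔ (succAbove? σ (inject₁ k)) (succAbove? π k)
    (subst₂ _<_ (FinP.toℕ-inject₁ k) toℕ-σk) (subst₂ _<_ (sym (FinP.toℕ-inject₁ k)) (sym toℕ-σk))
    where toℕ-σk = trans (cong toℕ σk≡πk) (FinP.toℕ-inject₁ _)

  succBelow-lift : ∀ k → lookup σ (inject₁ k) ≡ inject₁ (lookup π k) → succBelow σ (inject₁ k) ≡ succBelow π k
  succBelow-lift k σk≡πk = 𝟙-⇔ (succBelow? σ (inject₁ k)) (succBelow? π k)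
    (subst₂ _<_ toℕ-σk (FinP.toℕ-inject₁ k)) (subst₂ _<_ (sym toℕ-σk) (sym (FinP.toℕ-inject₁ k)))
    where toℕ-σk = trans (cong toℕ σk≡πk) (FinP.toℕ-inject₁ _)

  record SamePredecessor (k : Fin n) : Set where
    field
      lift   : ∀ j → lookup π j ≡ k → lookup σ (inject₁ j) ≡ inject₁ k
      lower  : ∀ j → lookup σ (inject₁ j) ≡ inject₁ k → lookup π j ≡ k
      notMax : lookup σ (fromℕ n) ≢ inject₁ k

  module _ {k : Fin n} (same : SamePredecessor k) where
    open SamePredecessor same

    private
      preimage-lower : ∀ {j′} → lookup σ j′ ≡ inject₁ k → ∃ λ j → j′ ≡ inject₁ j × lookup π j ≡ k
      preimage-lower {j′} σj′≡k with inject₁-view j′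
      ... | inj₁ refl      = ⊥-elim (notMax σj′≡k)
      ... | inj₂ (j , refl) = j , refl , lower j σj′≡k

    predBelow-lift : predBelow σ (inject₁ k) ≡ predBelow π k
    predBelow-lift = 𝟙-⇔ (predBelow? σ (inject₁ k)) (predBelow? π k)
      (λ { (j′ , σj′≡k , j′<k) → case-lower (preimage-lower σj′≡k) j′<k })
      (λ { (j , πj≡k , j<k) → inject₁ j , lift j πj≡k , subst₂ _<_ (sym (FinP.toℕ-inject₁ j)) (sym (FinP.toℕ-inject₁ k)) j<k })
      where
      case-lower : ∀ {j′} → (∃ λ j → j′ ≡ inject₁ j × lookup π j ≡ k) → toℕ j′ < toℕ (inject₁ k) → PredBelow π k
      case-lower (j , refl , πj≡k) j<k = j , πj≡k , subst₂ _<_ (FinP.toℕ-inject₁ j) (FinP.toℕ-inject₁ k) j<k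

    predAbove-lift : predAbove σ (inject₁ k) ≡ predAbove π k
    predAbove-lift = 𝟙-⇔ (predAbove? σ (inject₁ k)) (predAbove? π k)
      (λ { (j′ , σj′≡k , k<j′) → case-lower (preimage-lower σj′≡k) k<j′ })
      (λ { (j , πj≡k , k<j) → inject₁ j , lift j πj≡k , subst₂ _<_ (sym (FinP.toℕ-inject₁ k)) (sym (FinP.toℕ-inject₁ j)) k<j })
      where
      case-lower : ∀ {j′} → (∃ λ j → j′ ≡ inject₁ j × lookup π j ≡ k) → toℕ (inject₁ k) < toℕ j′ → PredAbove π k
      case-lower (j , refl , πj≡k) k<j = j , πj≡k , subst₂ _<_ (FinP.toℕ-inject₁ k) (FinP.toℕ-inject₁ j) k<j

module _ {n : ℕ} (σ : Vec (Fin (suc n)) (suc n)) where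

  predAbove-max : predAbove σ (fromℕ n) ≡ 0
  predAbove-max = 𝟙-no (predAbove? σ (fromℕ n)) (λ { (j , _ , n<j) → fromℕ≮ j n<j })

  succAbove-max : succAbove σ (fromℕ n) ≡ 0
  succAbove-max = 𝟙-no (succAbove? σ (fromℕ n)) (fromℕ≮ (lookup σ (fromℕ n)))

  ∑-init : (f : Fin (suc n) → ℕ) → f (fromℕ n) ≡ 0 → ∑[ i < suc n ] f i ≡ ∑[ k < n ] f (inject₁ k)
  ∑-init f f-max≡0 = trans (sum-init-last f) (trans (cong (sum (f ∘ inject₁) +_) f-max≡0) (+-identityʳ _))

∑-update : ∀ {n} (f g : Fin n → ℕ) a → (∀ k → a ≢ k → f k ≡ g k) → ∑[ i < n ] f i + g a ≡ ∑[ i < n ] g i + f a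
∑-update {suc n} f g a f≡g = begin
  sum f + g a                                ≡⟨ cong (_+ g a) (sum-remove {i = a} f) ⟩
  f a + sum (removeAt′ f) + g a               ≡⟨ cong (λ z → f a + z + g a) (sum-cong-≗ {n} away) ⟩
  f a + sum (removeAt′ g) + g a               ≡⟨ +-comm (f a + _) (g a) ⟩
  g a + (f a + sum (removeAt′ g))             ≡⟨ cong (g a +_) (+-comm (f a) _) ⟩
  g a + (sum (removeAt′ g) + f a)             ≡⟨ sym (+-assoc (g a) _ (f a)) ⟩
  g a + sum (removeAt′ g) + f a               ≡⟨ cong (_+ f a) (sym (sum-remove {i = a} g)) ⟩
  sum g + f a                                ∎
  where
  open ≡-Reasoning
  removeAt′ : (Fin (suc n) → ℕ) → Fin n → ℕ
  removeAt′ h = h ∘ punchIn a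
  away : ∀ k → f (punchIn a k) ≡ g (punchIn a k)
  away k = f≡g (punchIn a k) (FinP.punchInᵢ≢i a k ∘ sym)

∑-update₂ : ∀ {n} (f g : Fin n → ℕ) a b → a ≢ b → (∀ k → a ≢ k → b ≢ k → f k ≡ g k) →
            ∑[ i < n ] f i + g a + g b ≡ ∑[ i < n ] g i + f a + f b
∑-update₂ {n} f g a b a≢b f≡g = begin
  sum f + g a + g b    ≡⟨ cong (_+ g b) (trans (cong (sum f +_) (sym h-a)) (∑-update f h a f≡h)) ⟩
  sum h + f a + g b    ≡⟨ +-assoc (sum h) (f a) (g b) ⟩
  sum h + (f a + g b)  ≡⟨ cong (sum h +_) (+-comm (f a) (g b)) ⟩
  sum h + (g b + f a)  ≡⟨ sym (+-assoc (sum h) (g b) (f a)) ⟩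
  sum h + g b + f a    ≡⟨ cong (_+ f a) (∑-update h g b h≡g) ⟩
  sum g + h b + f a    ≡⟨ cong (λ z → sum g + z + f a) (updateAt-minimal b a f (a≢b ∘ sym)) ⟩
  sum g + f b + f a    ≡⟨ +-assoc (sum g) (f b) (f a) ⟩
  sum g + (f b + f a)  ≡⟨ cong (sum g +_) (+-comm (f b) (f a)) ⟩
  sum g + (f a + f b)  ≡⟨ sym (+-assoc (sum g) (f a) (f b)) ⟩
  sum g + f a + f b    ∎
  where
  open ≡-Reasoning
  h : Fin n → ℕ
  h = updateAt f a (λ _ → g a)
  h-a : h a ≡ g a
  h-a = updateAt-updates a f
  f≡h : ∀ k → a ≢ k → f k ≡ h k
  f≡h k a≢k = sym (updateAt-minimal k a f (a≢k ∘ sym))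
  h≡g : ∀ k → b ≢ k → h k ≡ g k
  h≡g k b≢k with a FinP.≟ k
  ... | yes refl = h-a
  ... | no a≢k   = trans (updateAt-minimal k a f (a≢k ∘ sym)) (f≡g k a≢k b≢k)

Weight : Set
Weight = ℕ → ℕ → ℕ → ℕ

weigh : ∀ {n} → Weight → Vec (Fin n) n → ℕ
weigh F π = F (cval π) (cdd π) (cda π)

module _ {n : ℕ} (σ : Vec (Fin (suc n)) (suc n)) where

  cval-init : cval σ ≡ ∑[ k < n ] (predAbove σ (inject₁ k) * succAbove σ (inject₁ k))
  cval-init = ∑-init σ (λ i → predAbove σ i * succAbove σ i) (cong (_* succAbove σ (fromℕ n)) (predAbove-max σ))

  cdd-init : cdd σ ≡ ∑[ k < n ] (predAbove σ (inject₁ k) * succBelow σ (inject₁ k))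
  cdd-init = ∑-init σ (λ i → predAbove σ i * succBelow σ i) (cong (_* succBelow σ (fromℕ n)) (predAbove-max σ))

  cda-init : cda σ ≡ ∑[ k < n ] (predBelow σ (inject₁ k) * succAbove σ (inject₁ k))
  cda-init = ∑-init σ (λ i → predBelow σ i * succAbove σ i)
              (trans (cong (predBelow σ (fromℕ n) *_) (succAbove-max σ)) (*-zeroʳ (predBelow σ (fromℕ n))))

module FixedInsertion {n : ℕ} (π : Vec (Fin n) n) where

  private
    σ = cycleInsert π F.zero

    same-succ : ∀ k → lookup σ (inject₁ k) ≡ inject₁ (lookup π k)
    same-succ = cycleInsert₀-inject₁ π

    same-pred : ∀ k → SamePredecessor σ π k
    same-pred k = record
      { lift   = λ j πj≡k → trans (same-succ j) (cong inject₁ πj≡k)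
      ; lower  = λ j σj≡k → FinP.inject₁-injective (trans (sym (same-succ j)) σj≡k)
      ; notMax = λ σn≡k → FinP.fromℕ≢inject₁ (trans (sym (cycleInsert₀-max π)) σn≡k)
      }

  weigh-fixedInsert : ∀ F → weigh F σ ≡ weigh F π
  weigh-fixedInsert F = cong₃ F
    (trans (cval-init σ) (sum-cong-≗ {n} λ k → cong₂ _*_ (predAbove-lift σ π (same-pred k)) (succAbove-lift σ π k (same-succ k))))
    (trans (cdd-init σ)  (sum-cong-≗ {n} λ k → cong₂ _*_ (predAbove-lift σ π (same-pred k)) (succBelow-lift σ π k (same-succ k))))
    (trans (cda-init σ)  (sum-cong-≗ {n} λ k → cong₂ _*_ (predBelow-lift σ π (same-pred k)) (succAbove-lift σ π k (same-succ k))))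
    where
    cong₃ : ∀ (F : Weight) {x y z x′ y′ z′} → x ≡ x′ → y ≡ y′ → z ≡ z′ → F x y z ≡ F x′ y′ z′
    cong₃ F refl refl refl = refl

-- The five ways inserting n into a cycle changes (cval, cdd, cda): a fixed point becomes a valley; after an
-- ascent a → b, a peak b becomes a double descent or a double ascent b becomes a valley; after a descent a → b,
-- a peak a becomes a double ascent or a double descent a becomes a valley.
moves : Weight → ℕ → ℕ → ℕ → (c₁ c₂ c₃ c₄ c₅ : ℕ) → ℕ
moves F v d e c₁ c₂ c₃ c₄ c₅ =
  c₁ * F (suc v) d e + c₂ * F v (suc d) e + c₃ * F (suc v) d (pred e) + c₄ * F v d (suc e) + c₅ * F (suc v) (pred d) e

module _ (F : Weight) (v d e : ℕ) where

  private
    X₁ = F (suc v) d e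
    X₂ = F v (suc d) e
    X₃ = F (suc v) d (pred e)
    X₄ = F v d (suc e)
    X₅ = F (suc v) (pred d) e

    moves₁ : moves F v d e 1 0 0 0 0 ≡ X₁
    moves₁ = solve 5 (λ x₁ x₂ x₃ x₄ x₅ → con 1 :* x₁ :+ con 0 :* x₂ :+ con 0 :* x₃ :+ con 0 :* x₄ :+ con 0 :* x₅ := x₁)
             refl X₁ X₂ X₃ X₄ X₅
    moves₂ : moves F v d e 0 1 0 0 0 ≡ X₂
    moves₂ = solve 5 (λ x₁ x₂ x₃ x₄ x₅ → con 0 :* x₁ :+ con 1 :* x₂ :+ con 0 :* x₃ :+ con 0 :* x₄ :+ con 0 :* x₅ := x₂)
             refl X₁ X₂ X₃ X₄ X₅
    moves₃ : moves F v d e 0 0 1 0 0 ≡ X₃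
    moves₃ = solve 5 (λ x₁ x₂ x₃ x₄ x₅ → con 0 :* x₁ :+ con 0 :* x₂ :+ con 1 :* x₃ :+ con 0 :* x₄ :+ con 0 :* x₅ := x₃)
             refl X₁ X₂ X₃ X₄ X₅
    moves₄ : moves F v d e 0 0 0 1 0 ≡ X₄
    moves₄ = solve 5 (λ x₁ x₂ x₃ x₄ x₅ → con 0 :* x₁ :+ con 0 :* x₂ :+ con 0 :* x₃ :+ con 1 :* x₄ :+ con 0 :* x₅ := x₄)
             refl X₁ X₂ X₃ X₄ X₅
    moves₅ : moves F v d e 0 0 0 0 1 ≡ X₅
    moves₅ = solve 5 (λ x₁ x₂ x₃ x₄ x₅ → con 0 :* x₁ :+ con 0 :* x₂ :+ con 0 :* x₃ :+ con 0 :* x₄ :+ con 1 :* x₅ := x₅)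
             refl X₁ X₂ X₃ X₄ X₅

    cong₃ : ∀ {x y z x′ y′ z′} → x ≡ x′ → y ≡ y′ → z ≡ z′ → F x y z ≡ F x′ y′ z′
    cong₃ refl refl refl = refl

    regroup : ∀ {x y} p q r s → x + p + q ≡ y + r + s → x + (p + q) ≡ y + (r + s)
    regroup {x} {y} p q r s eq = trans (sym (+-assoc x p q)) (trans eq (+-assoc y r s))

    cancel : ∀ {x y} m → x + m ≡ y + m → x ≡ y
    cancel {x} {y} m = +-cancelʳ-≡ m x y

    cancel-up : ∀ {x y} m → x + m ≡ y + suc m → x ≡ suc y
    cancel-up {x} {y} m eq = +-cancelʳ-≡ m x (suc y) (trans eq (+-suc y m))

    cancel-down : ∀ {x y} m → x + suc m ≡ y + m → x ≡ pred y
    cancel-down {x} {y} m eq = cong pred (+-cancelʳ-≡ m (suc x) y (trans (sym (+-suc x m)) eq))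

    one-of-two : ∀ x y → x + y ≡ 1 → (x ≡ 1 × y ≡ 0) ⊎ (x ≡ 0 × y ≡ 1)
    one-of-two 0 1 refl = inj₂ (refl , refl)
    one-of-two 1 0 refl = inj₁ (refl , refl)
    one-of-two 0 0 ()
    one-of-two 0 (suc (suc _)) ()
    one-of-two 1 (suc _) ()
    one-of-two (suc (suc _)) _ ()

  -- Ua, Da: a ascends/descends; Ba, Aa: a is entered from below/above; Ub, Db: b = π a ascends/descends.
  moves-moving : ∀ {v′ d′ e′} Ua Da Ba Aa Ub Db → Ua + Da ≡ 1 → Ba + Aa ≡ 1 → Ub + Db ≡ 1 →
    v′ + Aa * Ua + Da * Ub ≡ v + Aa * 1 + 1 * Ub →
    d′ + Aa * Da + Da * Db ≡ d + Aa * 0 + 1 * Db →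
    e′ + Ba * Ua + Ua * Ub ≡ e + Ba * 1 + 0 * Ub →
    F v′ d′ e′ ≡ moves F v d e 0 (Ua * Db) (Ua * Ub) (Da * Ba) (Da * Aa)
  moves-moving Ua Da Ba Aa Ub Db a-moves a-entered b-moves eqv eqd eqe
    with one-of-two Ua Da a-moves | one-of-two Ba Aa a-entered | one-of-two Ub Db b-moves
  ... | inj₁ (refl , refl) | inj₁ (refl , refl) | inj₁ (refl , refl) = trans
    (cong₃ (cancel-up 0 (regroup 0 0 0 1 eqv)) (cancel 0 (regroup 0 0 0 0 eqd)) (cancel-down 1 (regroup 1 1 1 0 eqe))) (sym moves₃)
  ... | inj₁ (refl , refl) | inj₂ (refl , refl) | inj₁ (refl , refl) = trans
    (cong₃ (cancel-up 1 (regroup 1 0 1 1 eqv)) (cancel 0 (regroup 0 0 0 0 eqd)) (cancel-down 0 (regroup 0 1 0 0 eqe))) (sym moves₃)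
  ... | inj₁ (refl , refl) | inj₁ (refl , refl) | inj₂ (refl , refl) = trans
    (cong₃ (cancel 0 (regroup 0 0 0 0 eqv)) (cancel-up 0 (regroup 0 0 0 1 eqd)) (cancel 1 (regroup 1 0 1 0 eqe))) (sym moves₂)
  ... | inj₁ (refl , refl) | inj₂ (refl , refl) | inj₂ (refl , refl) = trans
    (cong₃ (cancel 1 (regroup 1 0 1 0 eqv)) (cancel-up 0 (regroup 0 0 0 1 eqd)) (cancel 0 (regroup 0 0 0 0 eqe))) (sym moves₂)
  ... | inj₂ (refl , refl) | inj₁ (refl , refl) | inj₁ (refl , refl) = trans
    (cong₃ (cancel 1 (regroup 0 1 0 1 eqv)) (cancel 0 (regroup 0 0 0 0 eqd)) (cancel-up 0 (regroup 0 0 1 0 eqe))) (sym moves₄)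
  ... | inj₂ (refl , refl) | inj₁ (refl , refl) | inj₂ (refl , refl) = trans
    (cong₃ (cancel 0 (regroup 0 0 0 0 eqv)) (cancel 1 (regroup 0 1 0 1 eqd)) (cancel-up 0 (regroup 0 0 1 0 eqe))) (sym moves₄)
  ... | inj₂ (refl , refl) | inj₂ (refl , refl) | inj₁ (refl , refl) = trans
    (cong₃ (cancel-up 1 (regroup 0 1 1 1 eqv)) (cancel-down 0 (regroup 1 0 0 0 eqd)) (cancel 0 (regroup 0 0 0 0 eqe))) (sym moves₅)
  ... | inj₂ (refl , refl) | inj₂ (refl , refl) | inj₂ (refl , refl) = trans
    (cong₃ (cancel-up 0 (regroup 0 0 1 0 eqv)) (cancel-down 1 (regroup 1 1 0 1 eqd)) (cancel 0 (regroup 0 0 0 0 eqe))) (sym moves₅)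

  moves-fixed : ∀ {v′ d′ e′} Ua Da Ba Aa Ub Db → Ua ≡ 0 → Da ≡ 0 → Ba ≡ 0 → Aa ≡ 0 →
    v′ + Aa * Ua ≡ v + 1 * 1 → d′ + Aa * Da ≡ d + 1 * 0 → e′ + Ba * Ua ≡ e + 0 * 1 →
    F v′ d′ e′ ≡ moves F v d e 1 (Ua * Db) (Ua * Ub) (Da * Ba) (Da * Aa)
  moves-fixed .0 .0 .0 .0 Ub Db refl refl refl refl eqv eqd eqe =
    trans (cong₃ (cancel-up 0 eqv) (cancel 0 eqd) (cancel 0 eqe)) (sym moves₁)

module CycleInsertion {n : ℕ} (π : Vec (Fin n) n) (π-distinct : Distinct π) (a : Fin n) where

  private
    σ = cycleInsert π (F.suc a)
    b = lookup π a

    same-succ : ∀ k → a ≢ k → lookup σ (inject₁ k) ≡ inject₁ (lookup π k)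
    same-succ = cycleInsert-other π a

    same-pred : ∀ k → b ≢ k → SamePredecessor σ π k
    same-pred k b≢k = record
      { lift   = λ j πj≡k → trans (same-succ j (λ { refl → b≢k πj≡k })) (cong inject₁ πj≡k)
      ; lower  = lower
      ; notMax = λ σn≡k → b≢k (FinP.inject₁-injective (trans (sym (cycleInsert-max π a)) σn≡k))
      }
      where
      lower : ∀ j → lookup σ (inject₁ j) ≡ inject₁ k → lookup π j ≡ k
      lower j σj≡k with a FinP.≟ j
      ... | yes refl = ⊥-elim (FinP.fromℕ≢inject₁ (trans (sym (cycleInsert-at π a)) σj≡k))
      ... | no a≢j   = FinP.inject₁-injective (trans (sym (same-succ j a≢j)) σj≡k)

    succAbove-a : succAbove σ (inject₁ a) ≡ 1
    succAbove-a = 𝟙-yes (succAbove? σ (inject₁ a))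
      (subst (λ z → toℕ (inject₁ a) < toℕ z) (sym (cycleInsert-at π a)) (inject₁<fromℕ a))

    succBelow-a : succBelow σ (inject₁ a) ≡ 0
    succBelow-a = 𝟙-no (succBelow? σ (inject₁ a))
      (λ σa<a → fromℕ≮ (inject₁ a) (subst (λ z → toℕ z < toℕ (inject₁ a)) (cycleInsert-at π a) σa<a))

    predAbove-b : predAbove σ (inject₁ b) ≡ 1
    predAbove-b = 𝟙-yes (predAbove? σ (inject₁ b)) (fromℕ n , cycleInsert-max π a , inject₁<fromℕ b)

    predBelow-b : predBelow σ (inject₁ b) ≡ 0
    predBelow-b = 𝟙-no (predBelow? σ (inject₁ b)) λ { (j′ , σj′≡b , j′<b) → no-pred j′ σj′≡b j′<b }
      where
      no-pred : ∀ j′ → lookup σ j′ ≡ inject₁ b → toℕ j′ < toℕ (inject₁ b) → ⊥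
      no-pred j′ σj′≡b j′<b with inject₁-view j′
      ... | inj₁ refl = fromℕ≮ (inject₁ b) j′<b
      ... | inj₂ (j , refl) with a FinP.≟ j
      ...   | yes refl = FinP.fromℕ≢inject₁ (trans (sym (cycleInsert-at π a)) σj′≡b)
      ...   | no a≢j   = a≢j (π-distinct a j (sym (FinP.inject₁-injective (trans (sym (same-succ j a≢j)) σj′≡b))))

    A B U D : Fin n → ℕ
    A = predAbove π
    B = predBelow π
    U = succAbove π
    D = succBelow π

    A′ B′ U′ D′ : Fin n → ℕ
    A′ = predAbove σ ∘ inject₁
    B′ = predBelow σ ∘ inject₁
    U′ = succAbove σ ∘ inject₁
    D′ = succBelow σ ∘ inject₁

    A′≡A : ∀ k → b ≢ k → A′ k ≡ A k
    A′≡A k b≢k = predAbove-lift σ π (same-pred k b≢k)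
    B′≡B : ∀ k → b ≢ k → B′ k ≡ B k
    B′≡B k b≢k = predBelow-lift σ π (same-pred k b≢k)
    U′≡U : ∀ k → a ≢ k → U′ k ≡ U k
    U′≡U k a≢k = succAbove-lift σ π k (same-succ k a≢k)
    D′≡D : ∀ k → a ≢ k → D′ k ≡ D k
    D′≡D k a≢k = succBelow-lift σ π k (same-succ k a≢k)

  -- a is not a fixed point: σ changes the successor of a and the predecessor of b ≠ a.
  module Moving (a≢b : a ≢ b) where

    private
      change : (P P′ Q Q′ : Fin n → ℕ) → (∀ k → b ≢ k → P′ k ≡ P k) → (∀ k → a ≢ k → Q′ k ≡ Q k) →
               ∑[ k < n ] (P′ k * Q′ k) + P a * Q a + P b * Q b ≡ ∑[ k < n ] (P k * Q k) + P a * Q′ a + P′ b * Q b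
      change P P′ Q Q′ P′≡P Q′≡Q = begin
        ∑[ k < n ] (P′ k * Q′ k) + P a * Q a + P b * Q b
          ≡⟨ ∑-update₂ (λ k → P′ k * Q′ k) (λ k → P k * Q k) a b a≢b (λ k a≢k b≢k → cong₂ _*_ (P′≡P k b≢k) (Q′≡Q k a≢k)) ⟩
        ∑[ k < n ] (P k * Q k) + P′ a * Q′ a + P′ b * Q′ b
          ≡⟨ cong₂ (λ x y → ∑[ k < n ] (P k * Q k) + x * Q′ a + P′ b * y) (P′≡P a (a≢b ∘ sym)) (Q′≡Q b a≢b) ⟩
        ∑[ k < n ] (P k * Q k) + P a * Q′ a + P′ b * Q b ∎
        where open ≡-Reasoning

    cval-change : cval σ + A a * U a + A b * U b ≡ cval π + A a * 1 + 1 * U b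
    cval-change = begin
      cval σ + A a * U a + A b * U b  ≡⟨ cong (λ z → z + A a * U a + A b * U b) (cval-init σ) ⟩
      ∑[ k < n ] (A′ k * U′ k) + A a * U a + A b * U b ≡⟨ change A A′ U U′ A′≡A U′≡U ⟩
      cval π + A a * U′ a + A′ b * U b ≡⟨ cong₂ (λ x y → cval π + A a * x + y * U b) succAbove-a predAbove-b ⟩
      cval π + A a * 1 + 1 * U b     ∎
      where open ≡-Reasoning

    cdd-change : cdd σ + A a * D a + A b * D b ≡ cdd π + A a * 0 + 1 * D b
    cdd-change = begin
      cdd σ + A a * D a + A b * D b  ≡⟨ cong (λ z → z + A a * D a + A b * D b) (cdd-init σ) ⟩
      ∑[ k < n ] (A′ k * D′ k) + A a * D a + A b * D b ≡⟨ change A A′ D D′ A′≡A D′≡D ⟩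
      cdd π + A a * D′ a + A′ b * D b ≡⟨ cong₂ (λ x y → cdd π + A a * x + y * D b) succBelow-a predAbove-b ⟩
      cdd π + A a * 0 + 1 * D b      ∎
      where open ≡-Reasoning

    cda-change : cda σ + B a * U a + B b * U b ≡ cda π + B a * 1 + 0 * U b
    cda-change = begin
      cda σ + B a * U a + B b * U b  ≡⟨ cong (λ z → z + B a * U a + B b * U b) (cda-init σ) ⟩
      ∑[ k < n ] (B′ k * U′ k) + B a * U a + B b * U b ≡⟨ change B B′ U U′ B′≡B U′≡U ⟩
      cda π + B a * U′ a + B′ b * U b ≡⟨ cong₂ (λ x y → cda π + B a * x + y * U b) succAbove-a predBelow-b ⟩
      cda π + B a * 1 + 0 * U b      ∎
      where open ≡-Reasoning

  -- a is a fixed point of π, which σ turns into a valley.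
  module Fixed (a≡b : a ≡ b) where

    private
      change : (P P′ Q Q′ : Fin n → ℕ) → (∀ k → a ≢ k → P′ k ≡ P k) → (∀ k → a ≢ k → Q′ k ≡ Q k) →
               ∑[ k < n ] (P′ k * Q′ k) + P a * Q a ≡ ∑[ k < n ] (P k * Q k) + P′ a * Q′ a
      change P P′ Q Q′ P′≡P Q′≡Q =
        ∑-update (λ k → P′ k * Q′ k) (λ k → P k * Q k) a (λ k a≢k → cong₂ _*_ (P′≡P k a≢k) (Q′≡Q k a≢k))

      A′≡A′ : ∀ k → a ≢ k → A′ k ≡ A k
      A′≡A′ k a≢k = A′≡A k (subst (_≢ k) a≡b a≢k)
      B′≡B′ : ∀ k → a ≢ k → B′ k ≡ B k
      B′≡B′ k a≢k = B′≡B k (subst (_≢ k) a≡b a≢k)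
      predAbove-a : A′ a ≡ 1
      predAbove-a = subst (λ z → A′ z ≡ 1) (sym a≡b) predAbove-b
      predBelow-a : B′ a ≡ 0
      predBelow-a = subst (λ z → B′ z ≡ 0) (sym a≡b) predBelow-b

    cval-change : cval σ + A a * U a ≡ cval π + 1 * 1
    cval-change = trans (cong (_+ A a * U a) (cval-init σ))
      (trans (change A A′ U U′ A′≡A′ U′≡U) (cong₂ (λ x y → cval π + x * y) predAbove-a succAbove-a))

    cdd-change : cdd σ + A a * D a ≡ cdd π + 1 * 0
    cdd-change = trans (cong (_+ A a * D a) (cdd-init σ))
      (trans (change A A′ D D′ A′≡A′ D′≡D) (cong₂ (λ x y → cdd π + x * y) predAbove-a succBelow-a))

    cda-change : cda σ + B a * U a ≡ cda π + 0 * 1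
    cda-change = trans (cong (_+ B a * U a) (cda-init σ))
      (trans (change B B′ U U′ B′≡B′ U′≡U) (cong₂ (λ x y → cda π + x * y) predBelow-a succAbove-a))

  weigh-cycleInsert : ∀ F → weigh F σ ≡
    moves F (cval π) (cdd π) (cda π) (fixed π a) (U a * D b) (U a * U b) (D a * B a) (D a * A a)
  weigh-cycleInsert F with one-of-three (fixed π a) (U a) (D a) (fixed+succAbove+succBelow≡1 π a)
  ... | inj₁ (a-fixed , Ua≡0 , Da≡0) rewrite a-fixed =
    moves-fixed F (cval π) (cdd π) (cda π) (U a) (D a) (B a) (A a) (U b) (D b) Ua≡0 Da≡0
      (proj₁ no-pred) (proj₂ no-pred) cval-change cdd-change cda-change
    where
    open Fixed (sym (FinP.toℕ-injective (𝟙≡1⇒ (fixed? π a) a-fixed)))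
    no-pred : B a ≡ 0 × A a ≡ 0
    no-pred with one-of-three (fixed π a) (B a) (A a) (fixed+predBelow+predAbove≡1 π π-distinct a)
    ... | inj₁ (_ , Ba≡0 , Aa≡0) = Ba≡0 , Aa≡0
    ... | inj₂ (a-unfixed , _)   = ⊥-elim (0≢1+n (trans (sym a-unfixed) a-fixed))
  ... | inj₂ (a-unfixed , _) rewrite a-unfixed =
    moves-moving F (cval π) (cdd π) (cda π) (U a) (D a) (B a) (A a) (U b) (D b)
      (unfixed-succ a a-unfixed) (unfixed-pred a-unfixed) (unfixed-succ b (trans (fixed∘π≡fixed π π-distinct a) a-unfixed))
      (subst (λ x → cval σ + A a * U a + x * U b ≡ cval π + A a * 1 + 1 * U b) (predAbove∘π≡succBelow π π-distinct a) cval-change)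
      (subst (λ x → cdd σ + A a * D a + x * D b ≡ cdd π + A a * 0 + 1 * D b) (predAbove∘π≡succBelow π π-distinct a) cdd-change)
      (subst (λ x → cda σ + B a * U a + x * U b ≡ cda π + B a * 1 + 0 * U b) (predBelow∘π≡succAbove π π-distinct a) cda-change)
    where
    open Moving (λ a≡b → 0≢1+n (trans (sym a-unfixed) (𝟙-yes (fixed? π a) (cong toℕ (sym a≡b)))))
    unfixed-succ : ∀ k → fixed π k ≡ 0 → U k + D k ≡ 1
    unfixed-succ k k-unfixed = subst (λ f → f + U k + D k ≡ 1) k-unfixed (fixed+succAbove+succBelow≡1 π k)
    unfixed-pred : fixed π a ≡ 0 → B a + A a ≡ 1
    unfixed-pred a-unfixed = subst (λ f → f + B a + A a ≡ 1) a-unfixed (fixed+predBelow+predAbove≡1 π π-distinct a)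

∑-S-suc-cycleInsert : ∀ n (h : Vec (Fin (suc n)) (suc n) → ℕ) →
                      ∑[ σ ∈ S (suc n) ] h σ ≡ ∑[ π ∈ S n ] (∑[ j < suc n ] h (cycleInsert π j))
∑-S-suc-cycleInsert n = Enumeration.∑-S-suc cycleInsert cycleRemove cycleRemove∘cycleInsert cycleInsert-distinct
  (λ σ σ-distinct → proj₁ (cycleRemove-correct σ σ-distinct)) (λ σ σ-distinct → proj₂ (cycleRemove-correct σ σ-distinct))

∑-moves : ∀ {n} F v d e (c₁ c₂ c₃ c₄ c₅ : Fin n → ℕ) →
          ∑[ a < n ] moves F v d e (c₁ a) (c₂ a) (c₃ a) (c₄ a) (c₅ a) ≡ moves F v d e (sum c₁) (sum c₂) (sum c₃) (sum c₄) (sum c₅)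
∑-moves {n} F v d e c₁ c₂ c₃ c₄ c₅ = begin
  ∑[ a < n ] (term c₁ X₁ a + term c₂ X₂ a + term c₃ X₃ a + term c₄ X₄ a + term c₅ X₅ a)
    ≡⟨ ∑-distrib-+₅ (term c₁ X₁) (term c₂ X₂) (term c₃ X₃) (term c₄ X₄) (term c₅ X₅) ⟩
  sum (term c₁ X₁) + sum (term c₂ X₂) + sum (term c₃ X₃) + sum (term c₄ X₄) + sum (term c₅ X₅)
    ≡⟨ sym (cong₂ _+_ (cong₂ _+_ (cong₂ _+_ (cong₂ _+_ (*-distribʳ-sum X₁ c₁) (*-distribʳ-sum X₂ c₂))
                                             (*-distribʳ-sum X₃ c₃)) (*-distribʳ-sum X₄ c₄)) (*-distribʳ-sum X₅ c₅)) ⟩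
  moves F v d e (sum c₁) (sum c₂) (sum c₃) (sum c₄) (sum c₅) ∎
  where
  open ≡-Reasoning
  X₁ = F (suc v) d e
  X₂ = F v (suc d) e
  X₃ = F (suc v) d (pred e)
  X₄ = F v d (suc e)
  X₅ = F (suc v) (pred d) e
  term : (Fin n → ℕ) → ℕ → Fin n → ℕ
  term c X a = c a * X

transfer : ℕ → Weight → Weight
transfer n F v d e = F v d e + moves F v d e (n ∸ (2 * v + d + e)) v e v d

module _ {n : ℕ} (π : Vec (Fin n) n) (π-distinct : Distinct π) where

  cfix≡ : cfix π ≡ n ∸ (2 * cval π + cdd π + cda π)
  cfix≡ = begin
    cfix π                                                   ≡⟨ sym (m+n∸n≡m (cfix π) (2 * cval π + cdd π + cda π)) ⟩
    cfix π + (2 * cval π + cdd π + cda π) ∸ (2 * cval π + cdd π + cda π)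
      ≡⟨ cong (_∸ (2 * cval π + cdd π + cda π))
              (trans (reassoc (cfix π) (cval π) (cdd π) (cda π)) (cfix+2cval+cdd+cda≡n π π-distinct)) ⟩
    n ∸ (2 * cval π + cdd π + cda π)                         ∎
    where
    open ≡-Reasoning
    reassoc : ∀ f v d e → f + (2 * v + d + e) ≡ f + 2 * v + d + e
    reassoc = solve 4 (λ f v d e → f :+ (con 2 :* v :+ d :+ e) := f :+ con 2 :* v :+ d :+ e) refl

  ∑-weigh-cycleInsert : ∀ F → ∑[ j < suc n ] weigh F (cycleInsert π j) ≡ transfer n F (cval π) (cdd π) (cda π)
  ∑-weigh-cycleInsert F = begin
    weigh F (cycleInsert π F.zero) + ∑[ a < n ] weigh F (cycleInsert π (F.suc a))
      ≡⟨ cong₂ _+_ (FixedInsertion.weigh-fixedInsert π F)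
                   (sum-cong-≗ {n} (λ a → CycleInsertion.weigh-cycleInsert π π-distinct a F)) ⟩
    weigh F π + ∑[ a < n ] moves F v d e (fixed π a) (U a * D (lookup π a)) (U a * U (lookup π a)) (D a * B a) (D a * A a)
      ≡⟨ cong (weigh F π +_) (∑-moves F v d e (fixed π) _ _ _ _) ⟩
    weigh F π + moves F v d e (cfix π) (∑[ a < n ] (U a * D (lookup π a))) (∑[ a < n ] (U a * U (lookup π a)))
                                       (∑[ a < n ] (D a * B a)) (∑[ a < n ] (D a * A a))
      ≡⟨ cong (weigh F π +_) (cong₅ (moves F v d e) cfix≡ (trans (reindex D) (cpk≡cval π π-distinct)) (reindex U)
                                     (trans (swap D B) (cpk≡cval π π-distinct)) (swap D A)) ⟩
    transfer n F v d e ∎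
    where
    open ≡-Reasoning
    v = cval π
    d = cdd π
    e = cda π
    A B U D : Fin n → ℕ
    A = predAbove π
    B = predBelow π
    U = succAbove π
    D = succBelow π
    -- The ascent a → π a makes a the cycle predecessor of π a from below.
    reindex : ∀ (Q : Fin n → ℕ) → ∑[ a < n ] (U a * Q (lookup π a)) ≡ ∑[ b < n ] (B b * Q b)
    reindex Q = trans (sum-cong-≗ {n} (λ a → cong (_* Q (lookup π a)) (sym (predBelow∘π≡succAbove π π-distinct a))))
                      (∑-reindex π π-distinct (λ b → B b * Q b))
    swap : ∀ (P Q : Fin n → ℕ) → ∑[ a < n ] (P a * Q a) ≡ ∑[ a < n ] (Q a * P a)
    swap P Q = sum-cong-≗ {n} (λ a → *-comm (P a) (Q a))
    cong₅ : ∀ (G : ℕ → ℕ → ℕ → ℕ → ℕ → ℕ) {x₁ x₂ x₃ x₄ x₅ y₁ y₂ y₃ y₄ y₅} →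
            x₁ ≡ y₁ → x₂ ≡ y₂ → x₃ ≡ y₃ → x₄ ≡ y₄ → x₅ ≡ y₅ → G x₁ x₂ x₃ x₄ x₅ ≡ G y₁ y₂ y₃ y₄ y₅
    cong₅ G refl refl refl refl refl = refl

transfer-theorem : ∀ n F → ∑[ σ ∈ S (suc n) ] weigh F σ ≡ ∑[ π ∈ S n ] transfer n F (cval π) (cdd π) (cda π)
transfer-theorem n F = trans (∑-S-suc-cycleInsert n (weigh F))
  (∑∈-cong (S n) (λ π π∈S → ∑-weigh-cycleInsert π (∈-S⇒distinct π∈S) F))

cycleStats-bound : ∀ {n} (π : Vec (Fin n) n) → Distinct π → 2 * cval π + cdd π + cda π ≤ n
cycleStats-bound {n} π π-distinct = subst (2 * cval π + cdd π + cda π ≤_) (cfix+2cval+cdd+cda≡n π π-distinct)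
  (+-monoˡ-≤ (cda π) (+-monoˡ-≤ (cdd π) (m≤n+m (2 * cval π) (cfix π))))

cval-insertionRule : InsertionRule cval
cval-insertionRule n k = trans (transfer-theorem n (λ v _ _ → 𝟙 (v ≟ k)))
  (∑∈-cong (S n) (λ π π∈S → collect (cval π) (cdd π) (cda π) (cycleStats-bound π (∈-S⇒distinct π∈S))))
  where
  collect : ∀ v d e → 2 * v + d + e ≤ n →
    transfer n (λ v _ _ → 𝟙 (v ≟ k)) v d e ≡ 𝟙 (v ≟ k) * suc (2 * v) + 𝟙 (suc v ≟ k) * (n ∸ 2 * v)
  collect v d e bound = trans (regroup (𝟙 (v ≟ k)) (𝟙 (suc v ≟ k)) v d e f)
    (cong (λ z → 𝟙 (v ≟ k) * suc (2 * v) + 𝟙 (suc v ≟ k) * z) (sym n∸2v≡f+d+e))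
    where
    f = n ∸ (2 * v + d + e)
    regroup : ∀ x y v d e f → x + (f * y + v * x + e * y + v * x + d * y) ≡ x * suc (2 * v) + y * (f + d + e)
    regroup = solve 6 (λ x y v d e f → x :+ (f :* y :+ v :* x :+ e :* y :+ v :* x :+ d :* y)
                                       := x :* (con 1 :+ con 2 :* v) :+ y :* (f :+ d :+ e)) refl
    n∸2v≡f+d+e : n ∸ 2 * v ≡ f + d + e
    n∸2v≡f+d+e = begin
      n ∸ 2 * v                        ≡⟨ cong (_∸ 2 * v) (sym (m+[n∸m]≡n bound)) ⟩
      2 * v + d + e + f ∸ 2 * v        ≡⟨ cong (_∸ 2 * v) (rearrange v d e f) ⟩
      2 * v + (f + d + e) ∸ 2 * v      ≡⟨ m+n∸m≡n (2 * v) (f + d + e) ⟩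
      f + d + e                        ∎
      where
      open ≡-Reasoning
      rearrange : ∀ v d e f → 2 * v + d + e + f ≡ 2 * v + (f + d + e)
      rearrange = solve 4 (λ v d e f → con 2 :* v :+ d :+ e :+ f := con 2 :* v :+ (f :+ d :+ e)) refl

cvalCount≡lpkNumber : ∀ n k → count cval n k ≡ lpkNumber n k
cvalCount≡lpkNumber = count≡lpkNumber cval refl cval-insertionRule

module _ where
  open import Algebra.Definitions.RawSemiring (CommutativeSemiring.rawSemiring +-*-commutativeSemiring)
    using () renaming (_^_ to _^ₛ_; _×_ to _×ₛ_)

  ∑-binomial : ∀ m → ∑[ e < suc m ] (m choose toℕ e) ≡ 2 ^ m
  ∑-binomial m = sym (begin
    2 ^ m                                                          ≡⟨ sym (^ₛ≡^ 2 m) ⟩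
    (1 + 1) ^ₛ m                                                   ≡⟨ Binomial.theorem m 1 1 ⟩
    ∑[ e < suc m ] ((m choose toℕ e) ×ₛ (1 ^ₛ toℕ e * 1 ^ₛ (m ∸ toℕ e)))
      ≡⟨ sum-cong-≗ {suc m} (λ e → trans (cong ((m choose toℕ e) ×ₛ_) (cong₂ _*_ (1^ₛ (toℕ e)) (1^ₛ (m ∸ toℕ e))))
                                          (×ₛ1 (m choose toℕ e))) ⟩
    ∑[ e < suc m ] (m choose toℕ e)                                     ∎)
    where
    open ≡-Reasoning
    ^ₛ≡^ : ∀ x m → x ^ₛ m ≡ x ^ m
    ^ₛ≡^ x zero    = refl
    ^ₛ≡^ x (suc m) = cong (x *_) (^ₛ≡^ x m)
    1^ₛ : ∀ k → 1 ^ₛ k ≡ 1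
    1^ₛ zero    = refl
    1^ₛ (suc k) = trans (+-identityʳ _) (1^ₛ k)
    ×ₛ1 : ∀ n → n ×ₛ 1 ≡ n
    ×ₛ1 zero    = refl
    ×ₛ1 (suc n) = cong suc (×ₛ1 n)

C-absorption : ∀ m e → suc e * (suc m choose suc e) ≡ suc m * (m choose e)
C-absorption zero    zero    = refl
C-absorption zero    (suc e) = trans (cong (suc (suc e) *_) (k>n⇒nCk≡0 {1} {suc (suc e)} (s≤s (s≤s z≤n))))
                                     (trans (*-zeroʳ (suc (suc e))) (sym (cong (1 *_) (k>n⇒nCk≡0 {0} {suc e} (s≤s z≤n)))))
C-absorption (suc m) zero    = trans (*-identityˡ _) (trans (nC1≡n (suc (suc m))) (sym (*-identityʳ (suc (suc m)))))
C-absorption (suc m) (suc e) = begin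
  suc (suc e) * (suc (suc m) choose suc (suc e))
    ≡⟨ cong (suc (suc e) *_) (sym (nCk+nC[k+1]≡[n+1]C[k+1] (suc m) (suc e))) ⟩
  suc (suc e) * (suc m choose suc e + suc m choose suc (suc e))
    ≡⟨ *-distribˡ-+ (suc (suc e)) (suc m choose suc e) _ ⟩
  suc (suc e) * (suc m choose suc e) + suc (suc e) * (suc m choose suc (suc e))
    ≡⟨ cong₂ _+_ (cong (suc m choose suc e +_) (C-absorption m e)) (C-absorption m (suc e)) ⟩
  suc m choose suc e + suc m * (m choose e) + suc m * (m choose suc e)
    ≡⟨ +-assoc (suc m choose suc e) _ _ ⟩
  suc m choose suc e + (suc m * (m choose e) + suc m * (m choose suc e))
    ≡⟨ cong (suc m choose suc e +_) (trans (sym (*-distribˡ-+ (suc m) (m choose e) _))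
                                           (cong (suc m *_) (nCk+nC[k+1]≡[n+1]C[k+1] m e))) ⟩
  suc (suc m) * (suc m choose suc e) ∎
  where open ≡-Reasoning

shuffles : ℕ → ℕ → ℕ
shuffles d e = (d + e) choose e

shuffles-zeroˡ : ∀ e → shuffles 0 e ≡ 1
shuffles-zeroˡ = nCn≡1

shuffles-suc : ∀ d e → shuffles (suc d) (suc e) ≡ shuffles d (suc e) + shuffles (suc d) e
shuffles-suc d e = begin
  suc (d + suc e) choose suc e              ≡⟨ cong (λ z → suc z choose suc e) (+-suc d e) ⟩
  suc (suc (d + e)) choose suc e            ≡⟨ sym (nCk+nC[k+1]≡[n+1]C[k+1] (suc (d + e)) e) ⟩
  suc (d + e) choose e + suc (d + e) choose suc e ≡⟨ +-comm (suc (d + e) choose e) _ ⟩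
  suc (d + e) choose suc e + suc (d + e) choose e ≡⟨ cong (λ z → z choose suc e + suc (d + e) choose e) (sym (+-suc d e)) ⟩
  (d + suc e) choose suc e + suc (d + e) choose e ∎
  where open ≡-Reasoning

shuffles-absorbʳ : ∀ d e → suc e * shuffles d (suc e) ≡ suc (d + e) * shuffles d e
shuffles-absorbʳ d e = trans (cong (λ z → suc e * (z choose suc e)) (+-suc d e)) (C-absorption (d + e) e)

shuffles-absorbˡ : ∀ d e → suc d * shuffles (suc d) e ≡ suc (d + e) * shuffles d e
shuffles-absorbˡ d e = begin
  suc d * (suc (d + e) choose e)          ≡⟨ cong (suc d *_) (symmetric (suc d) e) ⟩
  suc d * (suc (d + e) choose suc d)      ≡⟨ C-absorption (d + e) d ⟩
  suc (d + e) * ((d + e) choose d)        ≡⟨ cong (suc (d + e) *_) (sym (symmetric d e)) ⟩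
  suc (d + e) * ((d + e) choose e)        ∎
  where
  open ≡-Reasoning
  symmetric : ∀ d e → (d + e) choose e ≡ (d + e) choose d
  symmetric d e = trans (nCk≡nC[n∸k] (m≤n+m e d)) (cong ((d + e) choose_) (m+n∸n≡m d e))

isStats : ℕ → ℕ → ℕ → Weight
isStats k d e v d′ e′ = 𝟙 (v ≟ k) * 𝟙 (d′ ≟ d) * 𝟙 (e′ ≟ e)

cycleCount : ℕ → ℕ → ℕ → ℕ → ℕ
cycleCount n k d e = ∑[ π ∈ S n ] weigh (isStats k d e) π

whenSuc : ℕ → (ℕ → ℕ) → ℕ
whenSuc zero    g = 0
whenSuc (suc k) g = g k

fixedPoints : ℕ → ℕ → ℕ → ℕ → ℕ
fixedPoints n d e k = n ∸ (2 * k + d + e)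

isStats-pin : ∀ (c : Weight) k d e v d′ e′ → c v d′ e′ * isStats k d e v d′ e′ ≡ c k d e * isStats k d e v d′ e′
isStats-pin c k d e v d′ e′ = pin (v ≟ k) (d′ ≟ d) (e′ ≟ e)
  where
  pin : (x : Dec (v ≡ k)) (y : Dec (d′ ≡ d)) (z : Dec (e′ ≡ e)) →
        c v d′ e′ * (𝟙 x * 𝟙 y * 𝟙 z) ≡ c k d e * (𝟙 x * 𝟙 y * 𝟙 z)
  pin (yes refl) (yes refl) (yes refl) = refl
  pin (no _)     _          _          = trans (*-zeroʳ (c v d′ e′)) (sym (*-zeroʳ (c k d e)))
  pin (yes _)    (no _)     _          = trans (*-zeroʳ (c v d′ e′)) (sym (*-zeroʳ (c k d e)))
  pin (yes _)    (yes _)    (no _)     = trans (*-zeroʳ (c v d′ e′)) (sym (*-zeroʳ (c k d e)))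

∑∈-whenSuc : ∀ {A : Set} (xs : List A) k (c : ℕ → ℕ) (g : ℕ → A → ℕ) →
             ∑[ x ∈ xs ] whenSuc k (λ k′ → c k′ * g k′ x) ≡ whenSuc k (λ k′ → c k′ * ∑∈ xs (g k′))
∑∈-whenSuc xs zero    c g = ∑∈-zero xs
∑∈-whenSuc xs (suc k) c g = *-distribˡ-∑∈ xs (c k) (g k)

cycleCount-suc : ∀ n k d e → cycleCount (suc n) k d e ≡
  cycleCount n k d e + (whenSuc k (λ k′ → fixedPoints n d e k′ * cycleCount n k′ d e)
                       + whenSuc d (λ d₀ → k * cycleCount n k d₀ e)
                       + whenSuc k (λ k′ → suc e * cycleCount n k′ d (suc e))
                       + whenSuc e (λ e₀ → k * cycleCount n k d e₀)
                       + whenSuc k (λ k′ → suc d * cycleCount n k′ (suc d) e))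
cycleCount-suc n k d e = begin
  cycleCount (suc n) k d e
    ≡⟨ transfer-theorem n (isStats k d e) ⟩
  ∑[ π ∈ S n ] transfer n (isStats k d e) (cval π) (cdd π) (cda π)
    ≡⟨ ∑∈-cong (S n) (λ π _ → terms (cval π) (cdd π) (cda π)) ⟩
  ∑[ π ∈ S n ] (weigh (isStats k d e) π + (T₁ π + T₂ π + T₃ π + T₄ π + T₅ π))
    ≡⟨ ∑∈-distrib-+ (S n) (weigh (isStats k d e)) _ ⟩
  cycleCount n k d e + ∑[ π ∈ S n ] (T₁ π + T₂ π + T₃ π + T₄ π + T₅ π)
    ≡⟨ cong (cycleCount n k d e +_) (∑∈-distrib-+₅ T₁ T₂ T₃ T₄ T₅) ⟩
  cycleCount n k d e + (∑∈ (S n) T₁ + ∑∈ (S n) T₂ + ∑∈ (S n) T₃ + ∑∈ (S n) T₄ + ∑∈ (S n) T₅)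
    ≡⟨ cong (cycleCount n k d e +_) (cong₂ _+_ (cong₂ _+_ (cong₂ _+_ (cong₂ _+_
         (∑∈-whenSuc (S n) k (fixedPoints n d e) (λ k′ → weigh (isStats k′ d e)))
         (∑∈-whenSuc (S n) d (λ _ → k) (λ d₀ → weigh (isStats k d₀ e))))
         (∑∈-whenSuc (S n) k (λ _ → suc e) (λ k′ → weigh (isStats k′ d (suc e)))))
         (∑∈-whenSuc (S n) e (λ _ → k) (λ e₀ → weigh (isStats k d e₀))))
         (∑∈-whenSuc (S n) k (λ _ → suc d) (λ k′ → weigh (isStats k′ (suc d) e)))) ⟩
  _ ∎
  where
  open ≡-Reasoning
  T₁ T₂ T₃ T₄ T₅ : Vec (Fin n) n → ℕ
  T₁ π = whenSuc k (λ k′ → fixedPoints n d e k′ * weigh (isStats k′ d e) π)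
  T₂ π = whenSuc d (λ d₀ → k * weigh (isStats k d₀ e) π)
  T₃ π = whenSuc k (λ k′ → suc e * weigh (isStats k′ d (suc e)) π)
  T₄ π = whenSuc e (λ e₀ → k * weigh (isStats k d e₀) π)
  T₅ π = whenSuc k (λ k′ → suc d * weigh (isStats k′ (suc d) e) π)

  ∑∈-distrib-+₅ : ∀ (f g h i j : Vec (Fin n) n → ℕ) →
    ∑[ π ∈ S n ] (f π + g π + h π + i π + j π) ≡ ∑∈ (S n) f + ∑∈ (S n) g + ∑∈ (S n) h + ∑∈ (S n) i + ∑∈ (S n) j
  ∑∈-distrib-+₅ f g h i j =
    trans (∑∈-distrib-+ (S n) (λ π → f π + g π + h π + i π) j) (cong (_+ ∑∈ (S n) j)
    (trans (∑∈-distrib-+ (S n) (λ π → f π + g π + h π) i) (cong (_+ ∑∈ (S n) i)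
    (trans (∑∈-distrib-+ (S n) (λ π → f π + g π) h) (cong (_+ ∑∈ (S n) h) (∑∈-distrib-+ (S n) f g))))))

  terms : ∀ v d′ e′ → transfer n (isStats k d e) v d′ e′ ≡ isStats k d e v d′ e′ +
          (whenSuc k (λ k′ → fixedPoints n d e k′ * isStats k′ d e v d′ e′) + whenSuc d (λ d₀ → k * isStats k d₀ e v d′ e′)
           + whenSuc k (λ k′ → suc e * isStats k′ d (suc e) v d′ e′) + whenSuc e (λ e₀ → k * isStats k d e₀ v d′ e′)
           + whenSuc k (λ k′ → suc d * isStats k′ (suc d) e v d′ e′))
  terms v d′ e′ = cong (isStats k d e v d′ e′ +_)
    (cong₂ _+_ (cong₂ _+_ (cong₂ _+_ (cong₂ _+_ (fixed-to-valley k) (peak-to-dd d)) (da-to-valley k e′)) (peak-to-da e))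
               (dd-to-valley k d′))
    where
    fixed-to-valley : ∀ k → fixedPoints n d′ e′ v * isStats k d e (suc v) d′ e′
                            ≡ whenSuc k (λ k′ → fixedPoints n d e k′ * isStats k′ d e v d′ e′)
    fixed-to-valley zero     = *-zeroʳ (fixedPoints n d′ e′ v)
    fixed-to-valley (suc k′) = isStats-pin (λ v d′ e′ → fixedPoints n d′ e′ v) k′ d e v d′ e′
    peak-to-dd : ∀ d → v * isStats k d e v (suc d′) e′ ≡ whenSuc d (λ d₀ → k * isStats k d₀ e v d′ e′)
    peak-to-dd zero     = trans (cong (λ t → v * (t * 𝟙 (e′ ≟ e))) (*-zeroʳ (𝟙 (v ≟ k)))) (*-zeroʳ v)
    peak-to-dd (suc d₀) = isStats-pin (λ v _ _ → v) k d₀ e v d′ e′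
    da-to-valley : ∀ k e′ → e′ * isStats k d e (suc v) d′ (pred e′) ≡ whenSuc k (λ k′ → suc e * isStats k′ d (suc e) v d′ e′)
    da-to-valley zero     e′        = *-zeroʳ e′
    da-to-valley (suc k′) zero      = sym (trans (cong (suc e *_) (*-zeroʳ (𝟙 (v ≟ k′) * 𝟙 (d′ ≟ d)))) (*-zeroʳ (suc e)))
    da-to-valley (suc k′) (suc e″)  = isStats-pin (λ _ _ e′ → e′) k′ d (suc e) v d′ (suc e″)
    peak-to-da : ∀ e → v * isStats k d e v d′ (suc e′) ≡ whenSuc e (λ e₀ → k * isStats k d e₀ v d′ e′)
    peak-to-da zero     = trans (cong (v *_) (*-zeroʳ (𝟙 (v ≟ k) * 𝟙 (d′ ≟ d)))) (*-zeroʳ v)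
    peak-to-da (suc e₀) = isStats-pin (λ v _ _ → v) k d e₀ v d′ e′
    dd-to-valley : ∀ k d′ → d′ * isStats k d e (suc v) (pred d′) e′ ≡ whenSuc k (λ k′ → suc d * isStats k′ (suc d) e v d′ e′)
    dd-to-valley zero     d′       = *-zeroʳ d′
    dd-to-valley (suc k′) zero     = sym (trans (cong (λ t → suc d * (t * 𝟙 (e′ ≟ e))) (*-zeroʳ (𝟙 (v ≟ k′)))) (*-zeroʳ (suc d)))
    dd-to-valley (suc k′) (suc d″) = isStats-pin (λ _ d′ _ → d′) k′ (suc d) e v (suc d″) e′

shuffles-one : ∀ m → shuffles m 1 ≡ suc m
shuffles-one m = trans (nC1≡n (m + 1)) (+-comm m 1)

cycleCount₀-empty : ∀ k d e → d + e ≢ 0 → cycleCount 0 k d e ≡ 0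
cycleCount₀-empty k zero    zero    d+e≢0 = ⊥-elim (d+e≢0 refl)
cycleCount₀-empty k zero    (suc e) _     = cong (_+ 0) (*-zeroʳ (𝟙 (0 ≟ k) * 1))
cycleCount₀-empty k (suc d) e       _     = cong (λ z → z * 𝟙 (0 ≟ e) + 0) (*-zeroʳ (𝟙 (0 ≟ k)))

cycleCount-spread : ∀ n k d e → cycleCount n k d e ≡ shuffles d e * cycleCount n k (d + e) 0
cycleCount-spread zero k d e = base d e
  where
  vanishing : ∀ d e → d + e ≢ 0 → cycleCount 0 k d e ≡ shuffles d e * cycleCount 0 k (d + e) 0
  vanishing d e d+e≢0 = trans (cycleCount₀-empty k d e d+e≢0) (sym (trans
    (cong (shuffles d e *_) (cycleCount₀-empty k (d + e) 0 (d+e≢0 ∘ trans (sym (+-identityʳ (d + e))))))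
    (*-zeroʳ (shuffles d e))))
  base : ∀ d e → cycleCount 0 k d e ≡ shuffles d e * cycleCount 0 k (d + e) 0
  base zero    zero    = sym (+-identityʳ _)
  base zero    (suc e) = vanishing zero (suc e) (λ ())
  base (suc d) e       = vanishing (suc d) e (λ ())
cycleCount-spread (suc n) k d e = begin
  cycleCount (suc n) k d e
    ≡⟨ cycleCount-suc n k d e ⟩
  cycleCount n k d e + (Kfix + Dpeak + Kda + Epeak + Kdd)
    ≡⟨ regroup (cycleCount n k d e) Kfix Dpeak Kda Epeak Kdd ⟩
  cycleCount n k d e + Kfix + Kda + Kdd + (Dpeak + Epeak)
    ≡⟨ cong₂ _+_ (cong₂ _+_ (cong₂ _+_ (cong₂ _+_ (IH k d e) (fixed-part k)) (da-part k)) (dd-part k)) (peak-part d e) ⟩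
  b * M k m + b * Kfix′ + b * Kda′ + b * Kdd′ + b * Mpeak
    ≡⟨ factor b (M k m) Kfix′ Kda′ Kdd′ Mpeak ⟩
  b * (M k m + (Kfix′ + Mpeak + Kda′ + 0 + Kdd′))
    ≡⟨ cong (b *_) (sym (cycleCount-suc n k m 0)) ⟩
  b * cycleCount (suc n) k m 0 ∎
  where
  open ≡-Reasoning
  IH = cycleCount-spread n
  m = d + e
  b = shuffles d e
  M : ℕ → ℕ → ℕ
  M k m = cycleCount n k m 0

  Kfix  = whenSuc k (λ k′ → fixedPoints n d e k′ * cycleCount n k′ d e)
  Dpeak = whenSuc d (λ d₀ → k * cycleCount n k d₀ e)
  Kda   = whenSuc k (λ k′ → suc e * cycleCount n k′ d (suc e))
  Epeak = whenSuc e (λ e₀ → k * cycleCount n k d e₀)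
  Kdd   = whenSuc k (λ k′ → suc d * cycleCount n k′ (suc d) e)
  Kfix′ = whenSuc k (λ k′ → fixedPoints n m 0 k′ * M k′ m)
  Mpeak = whenSuc m (λ m₀ → k * M k m₀)
  Kda′  = whenSuc k (λ k′ → 1 * cycleCount n k′ m 1)
  Kdd′  = whenSuc k (λ k′ → suc m * M k′ (suc m))

  regroup : ∀ x a b c d e → x + (a + b + c + d + e) ≡ x + a + c + e + (b + d)
  regroup = solve 6 (λ x a b c d e → x :+ (a :+ b :+ c :+ d :+ e) := x :+ a :+ c :+ e :+ (b :+ d)) refl
  factor : ∀ b x a c e m → b * x + b * a + b * c + b * e + b * m ≡ b * (x + (a + m + c + 0 + e))
  factor = solve 6 (λ b x a c e m → b :* x :+ b :* a :+ b :* c :+ b :* e :+ b :* m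
                                    := b :* (x :+ (a :+ m :+ c :+ con 0 :+ e))) refl
  swap : ∀ s b x → s * b * x ≡ b * (s * x)
  swap = solve 3 (λ s b x → s :* b :* x := b :* (s :* x)) refl

  fixed-part : ∀ k → whenSuc k (λ k′ → fixedPoints n d e k′ * cycleCount n k′ d e)
                     ≡ b * whenSuc k (λ k′ → fixedPoints n m 0 k′ * M k′ m)
  fixed-part zero     = sym (*-zeroʳ b)
  fixed-part (suc k′) = begin
    fixedPoints n d e k′ * cycleCount n k′ d e
      ≡⟨ cong₂ _*_ (cong (n ∸_) (trans (+-assoc (2 * k′) d e) (sym (+-identityʳ _)))) (IH k′ d e) ⟩
    fixedPoints n m 0 k′ * (b * M k′ m)
      ≡⟨ solve 3 (λ f b x → f :* (b :* x) := b :* (f :* x)) refl (fixedPoints n m 0 k′) b (M k′ m) ⟩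
    b * (fixedPoints n m 0 k′ * M k′ m)          ∎

  da-part : ∀ k → whenSuc k (λ k′ → suc e * cycleCount n k′ d (suc e)) ≡ b * whenSuc k (λ k′ → 1 * cycleCount n k′ m 1)
  da-part zero     = sym (*-zeroʳ b)
  da-part (suc k′) = begin
    suc e * cycleCount n k′ d (suc e)             ≡⟨ cong (suc e *_) (IH k′ d (suc e)) ⟩
    suc e * (shuffles d (suc e) * M k′ (d + suc e)) ≡⟨ sym (*-assoc (suc e) (shuffles d (suc e)) _) ⟩
    suc e * shuffles d (suc e) * M k′ (d + suc e)   ≡⟨ cong₂ _*_ (shuffles-absorbʳ d e) (cong (M k′) (+-suc d e)) ⟩
    suc m * b * M k′ (suc m)                      ≡⟨ swap (suc m) b (M k′ (suc m)) ⟩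
    b * (suc m * M k′ (suc m))                    ≡⟨ cong (b *_) (sym (trans (*-identityˡ _) (trans (IH k′ m 1) spread-one))) ⟩
    b * (1 * cycleCount n k′ m 1)                 ∎
    where
    spread-one : shuffles m 1 * M k′ (m + 1) ≡ suc m * M k′ (suc m)
    spread-one = cong₂ _*_ (shuffles-one m) (cong (M k′) (+-comm m 1))

  dd-part : ∀ k → whenSuc k (λ k′ → suc d * cycleCount n k′ (suc d) e) ≡ b * whenSuc k (λ k′ → suc m * M k′ (suc m))
  dd-part zero     = sym (*-zeroʳ b)
  dd-part (suc k′) = begin
    suc d * cycleCount n k′ (suc d) e              ≡⟨ cong (suc d *_) (IH k′ (suc d) e) ⟩
    suc d * (shuffles (suc d) e * M k′ (suc m))     ≡⟨ sym (*-assoc (suc d) (shuffles (suc d) e) _) ⟩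
    suc d * shuffles (suc d) e * M k′ (suc m)       ≡⟨ cong (_* M k′ (suc m)) (shuffles-absorbˡ d e) ⟩
    suc m * b * M k′ (suc m)                       ≡⟨ swap (suc m) b (M k′ (suc m)) ⟩
    b * (suc m * M k′ (suc m))                     ∎

  peak-part : ∀ d e → whenSuc d (λ d₀ → k * cycleCount n k d₀ e) + whenSuc e (λ e₀ → k * cycleCount n k d e₀)
                      ≡ shuffles d e * whenSuc (d + e) (λ m₀ → k * M k m₀)
  peak-part zero     zero     = refl
  peak-part (suc d₀) zero     = begin
    k * cycleCount n k d₀ 0 + 0   ≡⟨ +-identityʳ _ ⟩
    k * cycleCount n k d₀ 0       ≡⟨ cong (k *_) (trans (IH k d₀ 0) (*-identityˡ _)) ⟩
    k * M k (d₀ + 0)              ≡⟨ sym (*-identityˡ _) ⟩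
    1 * (k * M k (d₀ + 0))        ∎
  peak-part zero     (suc e₀) = begin
    k * cycleCount n k 0 e₀       ≡⟨ cong (k *_) (trans (IH k 0 e₀) (cong (_* M k e₀) (shuffles-zeroˡ e₀))) ⟩
    k * (1 * M k e₀)              ≡⟨ cong (k *_) (*-identityˡ _) ⟩
    k * M k e₀                    ≡⟨ sym (trans (cong (_* (k * M k e₀)) (shuffles-zeroˡ (suc e₀))) (*-identityˡ _)) ⟩
    shuffles 0 (suc e₀) * (k * M k e₀) ∎
  peak-part (suc d₀) (suc e₀) = begin
    k * cycleCount n k d₀ (suc e₀) + k * cycleCount n k (suc d₀) e₀
      ≡⟨ cong₂ (λ u w → k * u + k * w) (IH k d₀ (suc e₀))
               (trans (IH k (suc d₀) e₀) (cong (λ z → shuffles (suc d₀) e₀ * M k z) (sym (+-suc d₀ e₀)))) ⟩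
    k * (shuffles d₀ (suc e₀) * M k (d₀ + suc e₀)) + k * (shuffles (suc d₀) e₀ * M k (d₀ + suc e₀))
      ≡⟨ solve 4 (λ k x y z → k :* (x :* z) :+ k :* (y :* z) := (x :+ y) :* (k :* z)) refl
                 k (shuffles d₀ (suc e₀)) (shuffles (suc d₀) e₀) (M k (d₀ + suc e₀)) ⟩
    (shuffles d₀ (suc e₀) + shuffles (suc d₀) e₀) * (k * M k (d₀ + suc e₀))
      ≡⟨ cong (_* (k * M k (d₀ + suc e₀))) (sym (shuffles-suc d₀ e₀)) ⟩
    shuffles (suc d₀) (suc e₀) * (k * M k (d₀ + suc e₀)) ∎

∑-𝟙-pick : ∀ b y (g : ℕ → ℕ) → y < b → ∑[ e < b ] (𝟙 (y ≟ toℕ e) * g (toℕ e)) ≡ g y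
∑-𝟙-pick (suc b) zero    g _         = trans (cong₂ _+_ (+-identityʳ (g 0)) (sum-replicate-zero b)) (+-identityʳ (g 0))
∑-𝟙-pick (suc b) (suc y) g (s≤s y<b) = ∑-𝟙-pick b y (g ∘ suc) y<b

∑-𝟙-miss : ∀ b y (g : ℕ → ℕ) → b ≤ y → ∑[ e < b ] (𝟙 (y ≟ toℕ e) * g (toℕ e)) ≡ 0
∑-𝟙-miss zero    y       g _         = refl
∑-𝟙-miss (suc b) (suc y) g (s≤s b≤y) = ∑-𝟙-miss b y (g ∘ suc) b≤y

𝟙-+-split : ∀ x y m → 𝟙 (x + y ≟ m) ≡ ∑[ e < suc m ] (𝟙 (y ≟ toℕ e) * 𝟙 (x ≟ m ∸ toℕ e))
𝟙-+-split x y m with y ≤? m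
... | yes y≤m = trans (𝟙-⇔ (x + y ≟ m) (x ≟ m ∸ y) (λ e → trans (sym (m+n∸n≡m x y)) (cong (_∸ y) e))
                                                  (λ e → trans (cong (_+ y) e) (m∸n+n≡m y≤m)))
                      (sym (∑-𝟙-pick (suc m) y (λ e → 𝟙 (x ≟ m ∸ e)) (s≤s y≤m)))
... | no y≰m  = trans (𝟙-no (x + y ≟ m) (λ e → y≰m (subst (y ≤_) e (m≤n+m y x))))
                      (sym (∑-𝟙-miss (suc m) y (λ e → 𝟙 (x ≟ m ∸ e)) (≰⇒> y≰m)))

f≤∑f : ∀ {n} (f : Fin n → ℕ) i → f i ≤ ∑[ j < n ] f j
f≤∑f f F.zero    = m≤m+n _ _
f≤∑f f (F.suc i) = ≤-trans (f≤∑f (f ∘ F.suc) i) (m≤n+m _ _)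

module _ {n : ℕ} (π : Vec (Fin n) n) where

  exc≡∑succAbove : exc π ≡ ∑[ i < n ] succAbove π i
  exc≡∑succAbove = trans (length-filter (succAbove? π) (allFin n)) (∑∈-tabulate (λ i → i) (succAbove π))

  fix≡cfix : fix π ≡ cfix π
  fix≡cfix = trans (length-filter (fixed? π) (allFin n)) (∑∈-tabulate (λ i → i) (fixed π))

  noCDA⇔cda≡0 : 𝟙 (noCDA? π) ≡ 𝟙 (cda π ≟ 0)
  noCDA⇔cda≡0 = 𝟙-⇔ (noCDA? π) (cda π ≟ 0) no-cda⇒0 0⇒no-cda
    where
    cda-term : ∀ i → 𝟙 (cda? π i) ≡ predBelow π i * succAbove π i
    cda-term i = 𝟙-× (predBelow? π i) (succAbove? π i)
    no-cda⇒0 : NoCDA π → cda π ≡ 0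
    no-cda⇒0 no-cda = trans (sum-cong-≗ {n} (λ i → trans (sym (cda-term i)) (𝟙-no (cda? π i) (λ c → no-cda (i , c)))))
                            (sum-replicate-zero n)
    0⇒no-cda : cda π ≡ 0 → NoCDA π
    0⇒no-cda cda≡0 (i , c) = <⇒≱ z<s (subst (1 ≤_) cda≡0
      (subst (_≤ cda π) (trans (sym (cda-term i)) (𝟙-yes (cda? π i) c)) (f≤∑f (λ i → predBelow π i * succAbove π i) i)))

module _ {n : ℕ} (π : Vec (Fin n) n) (π-distinct : Distinct π) where

  private
    v = cval π
    d = cdd π
    e = cda π

  -- Without cycle double ascents, excedances are exactly cycle valleys, and n − fix − 2 exc = cdd.
  excWeight≡ : ∀ k → 𝟙 (noCDA? π) * (𝟙 (exc π ≟ k) * 2 ^ (n ∸ fix π ∸ 2 * exc π)) ≡ 𝟙 (e ≟ 0) * 𝟙 (v ≟ k) * 2 ^ d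
  excWeight≡ k = trans (cong (_* (𝟙 (exc π ≟ k) * 2 ^ (n ∸ fix π ∸ 2 * exc π))) (noCDA⇔cda≡0 π)) (by-cases (e ≟ 0))
    where
    exc≡cval : e ≡ 0 → exc π ≡ v
    exc≡cval e≡0 =
      trans (exc≡∑succAbove π) (trans (sym (cval+cda≡∑succAbove π π-distinct)) (trans (cong (v +_) e≡0) (+-identityʳ v)))
    remaining≡cdd : e ≡ 0 → n ∸ fix π ∸ 2 * exc π ≡ d
    remaining≡cdd e≡0 = begin
      n ∸ fix π ∸ 2 * exc π                 ≡⟨ cong₂ (λ f x → n ∸ f ∸ 2 * x) (fix≡cfix π) (exc≡cval e≡0) ⟩
      n ∸ cfix π ∸ 2 * v                    ≡⟨ cong (λ m → m ∸ cfix π ∸ 2 * v) (sym (cfix+2cval+cdd+cda≡n π π-distinct)) ⟩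
      cfix π + 2 * v + d + e ∸ cfix π ∸ 2 * v
        ≡⟨ cong (λ z → z ∸ cfix π ∸ 2 * v) (trans (cong (cfix π + 2 * v + d +_) e≡0) (trans (+-identityʳ _) (+-assoc (cfix π) (2 * v) d))) ⟩
      cfix π + (2 * v + d) ∸ cfix π ∸ 2 * v   ≡⟨ cong (_∸ 2 * v) (m+n∸m≡n (cfix π) (2 * v + d)) ⟩
      2 * v + d ∸ 2 * v                     ≡⟨ m+n∸m≡n (2 * v) d ⟩
      d                                     ∎
      where open ≡-Reasoning
    by-cases : (z : Dec (e ≡ 0)) → 𝟙 z * (𝟙 (exc π ≟ k) * 2 ^ (n ∸ fix π ∸ 2 * exc π)) ≡ 𝟙 z * 𝟙 (v ≟ k) * 2 ^ d
    by-cases (no _)    = refl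
    by-cases (yes e≡0) = begin
      1 * (𝟙 (exc π ≟ k) * 2 ^ (n ∸ fix π ∸ 2 * exc π))
        ≡⟨ cong (1 *_) (cong₂ (λ x y → 𝟙 (x ≟ k) * 2 ^ y) (exc≡cval e≡0) (remaining≡cdd e≡0)) ⟩
      1 * (𝟙 (v ≟ k) * 2 ^ d)                           ≡⟨ sym (*-assoc 1 (𝟙 (v ≟ k)) (2 ^ d)) ⟩
      1 * 𝟙 (v ≟ k) * 2 ^ d                             ∎
      where open ≡-Reasoning

  cdd≤n : d ≤ n
  cdd≤n = ≤-trans (m≤n+m d (2 * v)) (≤-trans (m≤m+n (2 * v + d) e) (cycleStats-bound π π-distinct))

  cdd+cda≤n : d + e ≤ n
  cdd+cda≤n = ≤-trans (m≤n+m (d + e) (2 * v)) (subst (_≤ n) (+-assoc (2 * v) d e) (cycleStats-bound π π-distinct))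

excCoeff≡∑cycleCount : ∀ n k → excCoeff n k ≡ ∑[ m < suc n ] (2 ^ toℕ m * cycleCount n k (toℕ m) 0)
excCoeff≡∑cycleCount n k = begin
  excCoeff n k
    ≡⟨ ∑∈-filter (λ π → exc π ≟ k) (C n) h ⟩
  ∑[ π ∈ C n ] (𝟙 (exc π ≟ k) * h π)
    ≡⟨ ∑∈-filter noCDA? (S n) (λ π → 𝟙 (exc π ≟ k) * h π) ⟩
  ∑[ π ∈ S n ] (𝟙 (noCDA? π) * (𝟙 (exc π ≟ k) * h π))
    ≡⟨ ∑∈-cong (S n) (λ π π∈S → trans (excWeight≡ π (∈-S⇒distinct π∈S) k) (sym (pick-cdd π (∈-S⇒distinct π∈S)))) ⟩
  ∑[ π ∈ S n ] (∑[ m < suc n ] (2 ^ toℕ m * weigh (isStats k (toℕ m) 0) π))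
    ≡⟨ ∑∈-∑-comm (S n) (suc n) (λ π m → 2 ^ toℕ m * weigh (isStats k (toℕ m) 0) π) ⟩
  ∑[ m < suc n ] (∑[ π ∈ S n ] (2 ^ toℕ m * weigh (isStats k (toℕ m) 0) π))
    ≡⟨ sum-cong-≗ {suc n} (λ m → *-distribˡ-∑∈ (S n) (2 ^ toℕ m) (weigh (isStats k (toℕ m) 0))) ⟩
  ∑[ m < suc n ] (2 ^ toℕ m * cycleCount n k (toℕ m) 0) ∎
  where
  open ≡-Reasoning
  h : Vec (Fin n) n → ℕ
  h π = 2 ^ (n ∸ fix π ∸ 2 * exc π)
  pick-cdd : ∀ π → Distinct π →
    ∑[ m < suc n ] (2 ^ toℕ m * weigh (isStats k (toℕ m) 0) π) ≡ 𝟙 (cda π ≟ 0) * 𝟙 (cval π ≟ k) * 2 ^ cdd π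
  pick-cdd π π-distinct = begin
    ∑[ m < suc n ] (2 ^ toℕ m * (𝟙 (cval π ≟ k) * 𝟙 (cdd π ≟ toℕ m) * 𝟙 (cda π ≟ 0)))
      ≡⟨ sum-cong-≗ {suc n} (λ m → shuffle (2 ^ toℕ m) (𝟙 (cval π ≟ k)) (𝟙 (cdd π ≟ toℕ m)) (𝟙 (cda π ≟ 0))) ⟩
    ∑[ m < suc n ] (𝟙 (cdd π ≟ toℕ m) * (2 ^ toℕ m * 𝟙 (cval π ≟ k) * 𝟙 (cda π ≟ 0)))
      ≡⟨ ∑-𝟙-pick (suc n) (cdd π) (λ m → 2 ^ m * 𝟙 (cval π ≟ k) * 𝟙 (cda π ≟ 0)) (s≤s (cdd≤n π π-distinct)) ⟩
    2 ^ cdd π * 𝟙 (cval π ≟ k) * 𝟙 (cda π ≟ 0)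
      ≡⟨ reverse (2 ^ cdd π) (𝟙 (cval π ≟ k)) (𝟙 (cda π ≟ 0)) ⟩
    𝟙 (cda π ≟ 0) * 𝟙 (cval π ≟ k) * 2 ^ cdd π ∎
    where
    shuffle : ∀ p a b c → p * (a * b * c) ≡ b * (p * a * c)
    shuffle = solve 4 (λ p a b c → p :* (a :* b :* c) := b :* (p :* a :* c)) refl
    reverse : ∀ a b c → a * b * c ≡ c * b * a
    reverse = solve 3 (λ a b c → a :* b :* c := c :* b :* a) refl

cvalCount≡∑cycleCount : ∀ n k → count cval n k ≡ ∑[ m < suc n ] (2 ^ toℕ m * cycleCount n k (toℕ m) 0)
cvalCount≡∑cycleCount n k = begin
  ∑[ π ∈ S n ] 𝟙 (cval π ≟ k)
    ≡⟨ ∑∈-cong (S n) (λ π π∈S → sym (∑-𝟙-pick (suc n) (cdd π + cda π) (λ _ → 𝟙 (cval π ≟ k))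
                                                (s≤s (cdd+cda≤n π (∈-S⇒distinct π∈S))))) ⟩
  ∑[ π ∈ S n ] (∑[ m < suc n ] (𝟙 (cdd π + cda π ≟ toℕ m) * 𝟙 (cval π ≟ k)))
    ≡⟨ ∑∈-∑-comm (S n) (suc n) (λ π m → 𝟙 (cdd π + cda π ≟ toℕ m) * 𝟙 (cval π ≟ k)) ⟩
  ∑[ m < suc n ] (∑[ π ∈ S n ] (𝟙 (cdd π + cda π ≟ toℕ m) * 𝟙 (cval π ≟ k)))
    ≡⟨ sum-cong-≗ {suc n} (λ m → split-total (toℕ m)) ⟩
  ∑[ m < suc n ] (2 ^ toℕ m * cycleCount n k (toℕ m) 0) ∎
  where
  open ≡-Reasoning
  split-total : ∀ m → ∑[ π ∈ S n ] (𝟙 (cdd π + cda π ≟ m) * 𝟙 (cval π ≟ k)) ≡ 2 ^ m * cycleCount n k m 0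
  split-total m = begin
    ∑[ π ∈ S n ] (𝟙 (cdd π + cda π ≟ m) * 𝟙 (cval π ≟ k))
      ≡⟨ ∑∈-cong (S n) (λ π _ → split π) ⟩
    ∑[ π ∈ S n ] (∑[ e < suc m ] weigh (isStats k (m ∸ toℕ e) (toℕ e)) π)
      ≡⟨ ∑∈-∑-comm (S n) (suc m) (λ π e → weigh (isStats k (m ∸ toℕ e) (toℕ e)) π) ⟩
    ∑[ e < suc m ] cycleCount n k (m ∸ toℕ e) (toℕ e)
      ≡⟨ sum-cong-≗ {suc m} (λ e → trans (cycleCount-spread n k (m ∸ toℕ e) (toℕ e))
                                          (cong (λ z → (z choose toℕ e) * cycleCount n k z 0) (m∸n+n≡m (s≤s⁻¹ (FinP.toℕ<n e))))) ⟩
    ∑[ e < suc m ] ((m choose toℕ e) * cycleCount n k m 0)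
      ≡⟨ sym (*-distribʳ-sum {suc m} (cycleCount n k m 0) (λ e → m choose toℕ e)) ⟩
    ∑[ e < suc m ] (m choose toℕ e) * cycleCount n k m 0
      ≡⟨ cong (_* cycleCount n k m 0) (∑-binomial m) ⟩
    2 ^ m * cycleCount n k m 0 ∎
    where
    split : ∀ π → 𝟙 (cdd π + cda π ≟ m) * 𝟙 (cval π ≟ k) ≡ ∑[ e < suc m ] weigh (isStats k (m ∸ toℕ e) (toℕ e)) π
    split π = begin
      𝟙 (cdd π + cda π ≟ m) * 𝟙 (cval π ≟ k)
        ≡⟨ cong (_* 𝟙 (cval π ≟ k)) (𝟙-+-split (cdd π) (cda π) m) ⟩
      ∑[ e < suc m ] (𝟙 (cda π ≟ toℕ e) * 𝟙 (cdd π ≟ m ∸ toℕ e)) * 𝟙 (cval π ≟ k)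
        ≡⟨ *-distribʳ-sum {suc m} (𝟙 (cval π ≟ k)) (λ e → 𝟙 (cda π ≟ toℕ e) * 𝟙 (cdd π ≟ m ∸ toℕ e)) ⟩
      ∑[ e < suc m ] (𝟙 (cda π ≟ toℕ e) * 𝟙 (cdd π ≟ m ∸ toℕ e) * 𝟙 (cval π ≟ k))
        ≡⟨ sum-cong-≗ {suc m} (λ e → reverse (𝟙 (cda π ≟ toℕ e)) (𝟙 (cdd π ≟ m ∸ toℕ e)) (𝟙 (cval π ≟ k))) ⟩
      ∑[ e < suc m ] weigh (isStats k (m ∸ toℕ e) (toℕ e)) π ∎
      where
      reverse : ∀ a b c → a * b * c ≡ c * b * a
      reverse = solve 3 (λ a b c → a :* b :* c := c :* b :* a) refl

corollary18 : (n : ℕ) → 1 ≤ n → (k : ℕ) → lpkCoeff n k ≡ excCoeff n k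
corollary18 n _ k = begin
  lpkCoeff n k                                           ≡⟨ lpkCoeff≡lpkNumber n k ⟩
  lpkNumber n k                                          ≡⟨ sym (cvalCount≡lpkNumber n k) ⟩
  count cval n k                                         ≡⟨ cvalCount≡∑cycleCount n k ⟩
  ∑[ m < suc n ] (2 ^ toℕ m * cycleCount n k (toℕ m) 0)  ≡⟨ sym (excCoeff≡∑cycleCount n k) ⟩
  excCoeff n k                                           ∎
  where open ≡-Reasoning
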